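{- Let $E$ be a finite set, let $\mathscr{L}_E$ be the set of Lagrangian subspaces of the symplectic space $V_E$ over $\mathbb{F}_2$, and let $\mathscr{B}_E$ be the set of binary delta-matroids with ground set $E$. Then the mapping $\nu_E$, which sends $L\in\mathscr{L}_E$ to the set system $(E;\Psi_L)$ with $\Psi_L=\{Y\subset E : L\cap\langle Y^\vee\sqcup(E\setminus Y)\rangle=0\}$, is a bijection from $\mathscr{L}_E$ onto $\mathscr{B}_E$.
   Context: Let $E^\vee$ be a disjoint copy of $E$, with $e^\vee\in E^\vee$ the copy of $e\in E$; for $Y\subset E$ write $Y^\vee=\{e^\vee:e\in Y\}$. $V_E$ is the $2|E|$-dimensional $\mathbb{F}_2$-vector space with basis $E\sqcup E^\vee$, with the symplectic (nondegenerate skew-symmetric) form defined on basis vectors by $(e,e^\vee)=(e^\vee,e)=1$ for $e\in E$ and $(u,v)=0$ for all other pairs of basis vectors. A subspace $L$ is Lagrangian if $(u,v)=0$ for all $u,v\in L$ and $\dim L=|E|$. Angle brackets denote the linear span in $V_E$, and $0$ is the zero subspace. A set system $(E;\Phi)$ is a finite set $E$ with a nonempty family $\Phi\subset 2^E$ of "feasible" subsets. A framed graph is a simple graph each of whose vertices carries a frame in $\mathbb{F}_2$; its adjacency matrix $A(G)$ over $\mathbb{F}_2$ has entry $1$ in position $(v,v')$, $v\ne v'$, iff $v,v'$ are adjacent, $0$ otherwise, and diagonal entries equal to the frames. $G$ is non-degenerate if $\det A(G)=1$ in $\mathbb{F}_2$ (the empty graph counts as non-degenerate). The non-degeneracy delta-matroid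 of $G$ is $(V(G);\Phi(G))$ with $\Phi(G)=\{U\subset V(G): \text{the induced subgraph } G_U \text{ is non-degenerate}\}$. For a set system $D=(E;\Phi)$ and $E'\subset E$, the twist is $D*E'=(E;\{\phi\,\Delta\, E':\phi\in\Phi\})$, where $\Delta$ is symmetric difference. A binary delta-matroid on $E$ is a set system of the form $(E;\Phi(G))*E'$ for some framed graph $G$ with vertex set $E$ and some (possibly empty) $E'\subset E$. -}

module Defs where

open import Data.Bool using (_≟_; Bool; true; false; _xor_; _∧_; if_then_else_; not)
open import Data.Nat using (ℕ; zero; suc)
open import Data.Fin using (Fin; zero; suc)
import Data.Fin
open import Data.Vec using (Vec; []; _∷_; zipWith; replicate; tabulate; lookup; foldr; toList)
open import Data.List using (List; []; _∷_; filter)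
open import Data.List.Base using (allFin)
open import Data.Product using (Σ; _×_; _,_; ∃; ∃-syntax)
open import Relation.Binary.PropositionalEquality using (_≡_)
open import Relation.Nullary using (does)
open import Function.Bundles using (_⇔_)
open import Data.Fin.Subset using (Subset)

-- The ground set E is Fin n.  The field 𝔽₂ is Bool (xor = +, ∧ = ·).

-- Vectors of V_E: coordinates w.r.t. the basis E ⊔ E^∨.
-- First component: coefficients of e ∈ E; second: coefficients of e^∨.
V : ℕ → Set
V n = Vec Bool n × Vec Bool n

0V : ∀ {n} → V n
0V = replicate _ false , replicate _ false

_+V_ : ∀ {n} → V n → V n → V n
(a , a') +V (b , b') = zipWith _xor_ a b , zipWith _xor_ a' b'

_·V_ : ∀ {n} → Bool → V n → V n
c ·V (a , a') = Data.Vec.map (c ∧_) a , Data.Vec.map (c ∧_) a'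

sumV : ∀ {n k} → (Fin k → V n) → V n
sumV {k = k} f = foldr _ _+V_ 0V (tabulate f)

lincomb : ∀ {n k} → (Fin k → Bool) → (Fin k → V n) → V n
lincomb c b = sumV (λ i → c i ·V b i)

sumB : ∀ {n} → Vec Bool n → Bool
sumB = foldr _ _xor_ false

-- symplectic form: (e,e^∨) = (e^∨,e) = 1, all other basis pairs 0,
-- extended bilinearly:  (u,v) = Σ_e (u_e v_{e^∨} + u_{e^∨} v_e)
form : ∀ {n} → V n → V n → Bool
form (a , a') (b , b') = sumB (zipWith _∧_ a b') xor sumB (zipWith _∧_ a' b)

unitVec : ∀ {n} → Fin n → Vec Bool n
unitVec i = tabulate (λ j → does (i Data.Fin.≟ j))

eV : ∀ {n} → Fin n → V n
eV i = unitVec i , replicate _ false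

e∨V : ∀ {n} → Fin n → V n
e∨V i = replicate _ false , unitVec i

SubsetV : ℕ → Set
SubsetV n = V n → Bool

IsSubspace : ∀ {n} → SubsetV n → Set
IsSubspace L = (L 0V ≡ true)
  × (∀ u v → L u ≡ true → L v ≡ true → L (u +V v) ≡ true)
  × (∀ c u → L u ≡ true → L (c ·V u) ≡ true)

HasDim : ∀ {n} → SubsetV n → ℕ → Set
HasDim {n} L d = Σ (Fin d → V n) λ b →
    (∀ (c : Fin d → Bool) → lincomb c b ≡ 0V → ∀ i → c i ≡ false)
  × (∀ v → (L v ≡ true) ⇔ (∃[ c ] lincomb c b ≡ v))

IsLagrangian : ∀ {n} → SubsetV n → Set
IsLagrangian {n} L = IsSubspace L
  × (∀ u v → L u ≡ true → L v ≡ true → form u v ≡ false)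
  × HasDim L n

InSpan : ∀ {n k} → (Fin k → V n) → V n → Set
InSpan w v = ∃[ c ] lincomb c w ≡ v

-- Set systems on E = Fin n: a family Φ ⊂ 2^E (nonemptiness stated separately)

Family : ℕ → Set₁
Family n = Subset n → Set

_≐_ : ∀ {n} → Family n → Family n → Set
Φ ≐ Ψ = ∀ X → Φ X ⇔ Ψ X

IsSetSystem : ∀ {n} → Family n → Set
IsSetSystem Φ = ∃[ X ] Φ X

-- the family Y^∨ ⊔ (E ∖ Y), indexed by E
dualGens : ∀ {n} → Subset n → Fin n → V n
dualGens Y i = if lookup Y i then e∨V i else eV i

Ψ : ∀ {n} → SubsetV n → Family n
Ψ L Y = ∀ v → L v ≡ true → InSpan (dualGens Y) v → v ≡ 0V

record FramedGraph (n : ℕ) : Set where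
  field
    adj     : Fin n → Fin n → Bool
    symm    : ∀ i j → adj i j ≡ adj j i
    noLoop  : ∀ i → adj i i ≡ false
    frame   : Fin n → Bool

adjMatrix : ∀ {n} → FramedGraph n → Fin n → Fin n → Bool
adjMatrix G i j = if does (i Data.Fin.≟ j) then FramedGraph.frame G i else FramedGraph.adj G i j

removeAt : ∀ {A : Set} (xs : List A) → Data.Fin.Fin (Data.List.length xs) → List A
removeAt (x ∷ xs) zero = xs
removeAt (x ∷ xs) (suc k) = x ∷ removeAt xs k

lookupL : ∀ {A : Set} (xs : List A) → Fin (Data.List.length xs) → A
lookupL (x ∷ xs) zero = x
lookupL (x ∷ xs) (suc k) = lookupL xs k

xorOver : ∀ {k} → (Fin k → Bool) → Bool
xorOver {zero} f = false
xorOver {suc k} f = f zero xor xorOver (λ i → f (suc i))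

-- determinant over 𝔽₂ of the submatrix of A with rows rs and columns cs
-- (|rs| = |cs|), by Laplace expansion along the first row (signs are 1 in 𝔽₂)
detSub : ∀ {n} → (Fin n → Fin n → Bool) → List (Fin n) → List (Fin n) → Bool
detSub A [] cs = true
detSub A (r ∷ rs) cs =
  xorOver (λ j → A r (lookupL cs j) ∧ detSub A rs (removeAt cs j))

elems : ∀ {n} → Subset n → List (Fin n)
elems U = filter (λ i → lookup U i ≟ true) (allFin _)

detInduced : ∀ {n} → FramedGraph n → Subset n → Bool
detInduced G U = detSub (adjMatrix G) (elems U) (elems U)

ΦG : ∀ {n} → FramedGraph n → Family n
ΦG G U = detInduced G U ≡ true

_Δ_ : ∀ {n} → Subset n → Subset n → Subset n
_Δ_ = zipWith _xor_

twist : ∀ {n} → Family n → Subset n → Family n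
twist Φ E' X = ∃[ φ ] (Φ φ × X ≡ φ Δ E')

IsBinaryDeltaMatroid : ∀ {n} → Family n → Set
IsBinaryDeltaMatroid {n} Φ =
  Σ (FramedGraph n) λ G → ∃[ E' ] (Φ ≐ twist (ΦG G) E')

-- Every Lagrangian L is transversal to some coordinate subspace W_S: build S along a basis of L,
-- flipping one coordinate whenever isotropy forces it. The partial duality swapping e_i and e_i^∨
-- for i ∈ S is a symplectic automorphism taking L to a Lagrangian transversal to W_∅ = ⟨E⟩, i.e. to
-- the graph {(Bz, z)} of a symmetric matrix B, and L ∩ W_X = 0 iff the principal submatrix of B on
-- X Δ S is nonsingular. Over 𝔽₂ a principal submatrix is nonsingular iff its Laplace-expansion
-- determinant is 1, so Ψ_L is the twist by S of the non-degeneracy delta-matroid of the framed graph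
-- with adjacency matrix B; conversely a twisted graph delta-matroid is Ψ of the swapped graph of its
-- adjacency matrix. Injectivity: B, hence L, is recovered from which 1×1 and 2×2 principal
-- submatrices of B are nonsingular (their determinants are B_ii and B_ii B_jj + B_ij).

module Submission where

open import Defs
open import Algebra.Bundles using (CommutativeMonoid; CommutativeRing)
import Algebra.Properties.CommutativeSemigroup as CommSemigroupProperties
open import Data.Bool using (Bool; true; false; _xor_; _∧_; _∨_; not; if_then_else_)
import Data.Bool as Bool
open import Data.Bool.Properties
  using (xor-comm; xor-assoc; xor-same; xor-identityʳ; ∧-comm; ∧-assoc; ∧-zeroʳ; ∧-identityʳ;
         ∧-distribˡ-xor; ∧-distribʳ-xor; ¬-not; ∧-commutativeMonoid; xor-∧-commutativeRing)
open import Data.Empty using (⊥; ⊥-elim)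
open import Data.Fin using (Fin; zero; suc; punchIn)
import Data.Fin as Fin
open import Data.Fin.Properties using (any?; all?; suc-injective)
open import Data.Fin.Subset.Properties using (anySubset?)
open import Data.Fin.Subset using (Subset) renaming (⊥ to ∅)
open import Data.List using (List; []; _∷_; length; allFin)
open import Data.List.Relation.Unary.All using (All; []; _∷_)
open import Data.List.Relation.Unary.AllPairs using (_∷_)
open import Data.List.Relation.Unary.Unique.Propositional using (Unique)
import Data.List.Relation.Unary.Unique.Propositional.Properties as UniqueProperties
open import Data.Nat using (ℕ; zero; suc; _<_; s≤s)
open import Data.Nat.Properties using (≤-refl; m≤n⇒m≤1+n)
open import Data.List.Properties using (length-tabulate)
import Data.Nat.Properties as ℕ
open import Data.Product using (_×_; _,_; ∃; ∃-syntax; proj₁; proj₂)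
open import Data.Sum using (_⊎_; inj₁; inj₂)
open import Data.Vec using (Vec; []; _∷_; lookup; tabulate; replicate)
open import Data.Vec.Functional using (insertAt) renaming (_∷_ to _∷ᶠ_)
open import Data.Vec.Functional.Properties using (insertAt-lookup; insertAt-punchIn)
open import Data.Vec.Properties using (lookup∘tabulate; lookup-replicate; lookup-zipWith; lookup-map; tabulate∘lookup; tabulate-cong)
open import Function using (_∘_)
open import Level using (0ℓ)
open import Function.Bundles using (_⇔_; mk⇔; Equivalence)
open import Function.Properties.Equivalence using (⇔-isEquivalence)
open import Relation.Binary.Structures using (IsEquivalence)
open import Relation.Binary.PropositionalEquality
open import Relation.Nullary using (Dec; yes; no; does)
open import Relation.Nullary.Decidable using (_×-dec_)

open CommSemigroupProperties
  (CommutativeRing.+-commutativeSemigroup xor-∧-commutativeRing)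
  using (interchange; x∙yz≈y∙xz)

open CommSemigroupProperties (CommutativeMonoid.commutativeSemigroup ∧-commutativeMonoid)
  using () renaming (x∙yz≈y∙xz to ∧-leftComm)

open IsEquivalence (⇔-isEquivalence {ℓ = 0ℓ}) using () renaming (sym to ⇔-sym; trans to ⇔-trans)

private
  variable
    n k m : ℕ

true≢false : true ≢ false
true≢false ()

∧≡true⇒ʳ : ∀ x y → x ∧ y ≡ true → y ≡ true
∧≡true⇒ʳ true y eq = eq

xor≡false⇒≡ : ∀ x y → x xor y ≡ false → x ≡ y
xor≡false⇒≡ false y eq = sym eq
xor≡false⇒≡ true false ()
xor≡false⇒≡ true true _ = refl

xor-cancelʳ : ∀ x y → (x xor y) xor y ≡ x
xor-cancelʳ x y = trans (xor-assoc x y y) (trans (cong (x xor_) (xor-same y)) (xor-identityʳ x))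

true⇔true⇒≡ : ∀ {x y} → (x ≡ true ⇔ y ≡ true) → x ≡ y
true⇔true⇒≡ {false} {false} _ = refl
true⇔true⇒≡ {false} {true} x⇔y = Equivalence.from x⇔y refl
true⇔true⇒≡ {true} {false} x⇔y = sym (Equivalence.to x⇔y refl)
true⇔true⇒≡ {true} {true} _ = refl

xorOver-cong : {f g : Fin k → Bool} → (∀ i → f i ≡ g i) → xorOver f ≡ xorOver g
xorOver-cong {zero} f≗g = refl
xorOver-cong {suc k} f≗g = cong₂ _xor_ (f≗g zero) (xorOver-cong (f≗g ∘ suc))

xorOver-xor : (f g : Fin k → Bool) → xorOver (λ i → f i xor g i) ≡ xorOver f xor xorOver g
xorOver-xor {zero} f g = refl
xorOver-xor {suc k} f g =
  trans (cong ((f zero xor g zero) xor_) (xorOver-xor (f ∘ suc) (g ∘ suc)))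
        (interchange (f zero) (g zero) _ _)

xorOver-∧ˡ : ∀ a (f : Fin k → Bool) → xorOver (λ i → a ∧ f i) ≡ a ∧ xorOver f
xorOver-∧ˡ {zero} a f = sym (∧-zeroʳ a)
xorOver-∧ˡ {suc k} a f =
  trans (cong ((a ∧ f zero) xor_) (xorOver-∧ˡ a (f ∘ suc))) (sym (∧-distribˡ-xor a _ _))

xorOver-∧ʳ : ∀ a (f : Fin k → Bool) → xorOver (λ i → f i ∧ a) ≡ xorOver f ∧ a
xorOver-∧ʳ a f = trans (xorOver-cong (λ i → ∧-comm (f i) a)) (trans (xorOver-∧ˡ a f) (∧-comm a _))

xorOver-zero : (f : Fin k → Bool) → (∀ i → f i ≡ false) → xorOver f ≡ false
xorOver-zero {zero} f f≡0 = refl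
xorOver-zero {suc k} f f≡0 rewrite f≡0 zero = xorOver-zero (f ∘ suc) (f≡0 ∘ suc)

xorOver-comm : (f : Fin k → Fin m → Bool) →
  xorOver (λ i → xorOver (f i)) ≡ xorOver (λ j → xorOver (λ i → f i j))
xorOver-comm {zero} {m} f = sym (xorOver-zero {m} _ (λ j → refl))
xorOver-comm {suc k} f =
  trans (cong (xorOver (f zero) xor_) (xorOver-comm (f ∘ suc))) (sym (xorOver-xor (f zero) _))

xorOver-single : ∀ (f : Fin k → Bool) j → (∀ i → i ≢ j → f i ≡ false) → xorOver f ≡ f j
xorOver-single {suc k} f zero f≡0 =
  trans (cong (f zero xor_) (xorOver-zero _ (λ i → f≡0 (suc i) (λ ())))) (xor-identityʳ _)
xorOver-single {suc k} f (suc j) f≡0 rewrite f≡0 zero (λ ()) =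
  xorOver-single (f ∘ suc) j (λ i i≢j → f≡0 (suc i) (i≢j ∘ suc-injective))

xorOver-punchIn : ∀ (f : Fin (suc k) → Bool) p → xorOver f ≡ f p xor xorOver (f ∘ punchIn p)
xorOver-punchIn f zero = refl
xorOver-punchIn {suc k} f (suc p) =
  trans (cong (f zero xor_) (xorOver-punchIn (f ∘ suc) p)) (x∙yz≈y∙xz (f zero) (f (suc p)) _)

allFalse-or-someTrue : (f : Fin k → Bool) → (∀ i → f i ≡ false) ⊎ ∃ λ i → f i ≡ true
allFalse-or-someTrue f with any? (λ i → f i Bool.≟ true)
... | yes someTrue = inj₂ someTrue
... | no noneTrue = inj₁ (λ i → ¬-not (λ fi≡true → noneTrue (i , fi≡true)))

xorOver-true : (f : Fin k → Bool) → xorOver f ≡ true → ∃ λ i → f i ≡ true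
xorOver-true f sum≡true with allFalse-or-someTrue f
... | inj₂ someTrue = someTrue
... | inj₁ allFalse with trans (sym sum≡true) (xorOver-zero f allFalse)
...   | ()

δ : Fin n → Fin n → Bool
δ i j = does (i Fin.≟ j)

δ-refl : (i : Fin n) → δ i i ≡ true
δ-refl i with i Fin.≟ i
... | yes _ = refl
... | no i≢i = ⊥-elim (i≢i refl)

δ-≢ : {i j : Fin n} → i ≢ j → δ i j ≡ false
δ-≢ {i = i} {j} i≢j with i Fin.≟ j
... | yes i≡j = ⊥-elim (i≢j i≡j)
... | no _ = refl

δ-true⇒≡ : {i j : Fin n} → δ i j ≡ true → i ≡ j
δ-true⇒≡ {i = i} {j} δij≡true with i Fin.≟ j
... | yes i≡j = i≡j

δ-sym : (i j : Fin n) → δ i j ≡ δ j i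
δ-sym i j with i Fin.≟ j | j Fin.≟ i
... | yes _ | yes _ = refl
... | no _ | no _ = refl
... | yes i≡j | no j≢i = ⊥-elim (j≢i (sym i≡j))
... | no i≢j | yes j≡i = ⊥-elim (i≢j (sym j≡i))

≢⇒δ≡false : ∀ {i j : Fin n} → j ≢ i → δ i j ≡ false
≢⇒δ≡false j≢i = δ-≢ (j≢i ∘ sym)

xorOver-∧δ : ∀ (f : Fin n → Bool) j → xorOver (λ i → f i ∧ δ i j) ≡ f j
xorOver-∧δ f j =
  trans (xorOver-single _ j (λ i i≢j → trans (cong (f i ∧_) (δ-≢ i≢j)) (∧-zeroʳ (f i))))
        (trans (cong (f j ∧_) (δ-refl j)) (∧-identityʳ (f j)))

xorOver-∧δ′ : ∀ (f : Fin n → Bool) j → xorOver (λ i → f i ∧ δ j i) ≡ f j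
xorOver-∧δ′ f j = trans (xorOver-cong (λ i → cong (f i ∧_) (δ-sym j i))) (xorOver-∧δ f j)

-- coord false v i is the coefficient of e_i in v, coord true v i that of e_i^∨.
coord : Bool → V n → Fin n → Bool
coord false (x , _) = lookup x
coord true (_ , ξ) = lookup ξ

lookup-ext : {A : Set} {xs ys : Vec A n} → (∀ i → lookup xs i ≡ lookup ys i) → xs ≡ ys
lookup-ext {xs = xs} {ys} eq =
  trans (sym (tabulate∘lookup xs)) (trans (tabulate-cong eq) (tabulate∘lookup ys))

V-ext : {v w : V n} → (∀ s i → coord s v i ≡ coord s w i) → v ≡ w
V-ext eq = cong₂ _,_ (lookup-ext (eq false)) (lookup-ext (eq true))

coord-0V : ∀ s (i : Fin n) → coord s 0V i ≡ false
coord-0V false i = lookup-replicate i false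
coord-0V true i = lookup-replicate i false

coord-+V : ∀ s (u v : V n) i → coord s (u +V v) i ≡ coord s u i xor coord s v i
coord-+V false u v i = lookup-zipWith _xor_ i (proj₁ u) (proj₁ v)
coord-+V true u v i = lookup-zipWith _xor_ i (proj₂ u) (proj₂ v)

coord-·V : ∀ s c (v : V n) i → coord s (c ·V v) i ≡ c ∧ coord s v i
coord-·V false c v i = lookup-map i (c ∧_) (proj₁ v)
coord-·V true c v i = lookup-map i (c ∧_) (proj₂ v)

coord-lincomb : ∀ s (c : Fin k → Bool) (b : Fin k → V n) i →
  coord s (lincomb c b) i ≡ xorOver (λ j → c j ∧ coord s (b j) i)
coord-lincomb {zero} s c b i = coord-0V s i
coord-lincomb {suc k} s c b i =
  trans (coord-+V s (c zero ·V b zero) (lincomb (c ∘ suc) (b ∘ suc)) i)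
        (cong₂ _xor_ (coord-·V s (c zero) (b zero) i) (coord-lincomb s (c ∘ suc) (b ∘ suc) i))

lincomb-xor : ∀ (c d : Fin k → Bool) (b : Fin k → V n) →
  lincomb c b +V lincomb d b ≡ lincomb (λ j → c j xor d j) b
lincomb-xor c d b = V-ext λ s i → begin
  coord s (lincomb c b +V lincomb d b) i
    ≡⟨ trans (coord-+V s _ _ i) (cong₂ _xor_ (coord-lincomb s c b i) (coord-lincomb s d b i)) ⟩
  xorOver (λ j → c j ∧ coord s (b j) i) xor xorOver (λ j → d j ∧ coord s (b j) i)
    ≡⟨ sym (xorOver-xor (λ j → c j ∧ coord s (b j) i) (λ j → d j ∧ coord s (b j) i)) ⟩
  xorOver (λ j → (c j ∧ coord s (b j) i) xor (d j ∧ coord s (b j) i))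
    ≡⟨ xorOver-cong (λ j → sym (∧-distribʳ-xor (coord s (b j) i) (c j) (d j))) ⟩
  xorOver (λ j → (c j xor d j) ∧ coord s (b j) i)
    ≡⟨ sym (coord-lincomb s _ b i) ⟩
  coord s (lincomb (λ j → c j xor d j) b) i ∎
  where open ≡-Reasoning

lincomb-tail : ∀ (c : Fin (suc k) → Bool) (b : Fin (suc k) → V n) → c zero ≡ false →
  lincomb c b ≡ lincomb (c ∘ suc) (b ∘ suc)
lincomb-tail c b c₀≡false = V-ext λ s i →
  trans (coord-lincomb s c b i)
        (trans (cong (λ t → (t ∧ coord s (b zero) i) xor xorOver (λ j → c (suc j) ∧ coord s (b (suc j)) i)) c₀≡false)
               (sym (coord-lincomb s (c ∘ suc) (b ∘ suc) i)))

lincomb-δ : ∀ (b : Fin k → V n) i → lincomb (λ j → δ j i) b ≡ b i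
lincomb-δ b i = V-ext λ s t →
  trans (coord-lincomb s _ b t)
        (trans (xorOver-cong (λ j → ∧-comm (δ j i) (coord s (b j) t))) (xorOver-∧δ (λ j → coord s (b j) t) i))

lincomb-cong : ∀ {c d : Fin k → Bool} (b : Fin k → V n) → (∀ i → c i ≡ d i) → lincomb c b ≡ lincomb d b
lincomb-cong b c≗d = V-ext λ s i →
  trans (coord-lincomb s _ b i)
        (trans (xorOver-cong (λ j → cong (_∧ coord s (b j) i) (c≗d j))) (sym (coord-lincomb s _ b i)))

formTerm : V n → V n → Fin n → Bool
formTerm v w i = (coord false v i ∧ coord true w i) xor (coord true v i ∧ coord false w i)

sumB-zipWith-∧ : (a b : Vec Bool n) → sumB (Data.Vec.zipWith _∧_ a b) ≡ xorOver (λ i → lookup a i ∧ lookup b i)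
sumB-zipWith-∧ [] [] = refl
sumB-zipWith-∧ (x ∷ a) (y ∷ b) = cong ((x ∧ y) xor_) (sumB-zipWith-∧ a b)

form-coord : (v w : V n) → form v w ≡ xorOver (formTerm v w)
form-coord (x , ξ) (y , η) =
  trans (cong₂ _xor_ (sumB-zipWith-∧ x η) (sumB-zipWith-∧ ξ y))
        (sym (xorOver-xor (λ i → lookup x i ∧ lookup η i) (λ i → lookup ξ i ∧ lookup y i)))

form-sym : (v w : V n) → form v w ≡ form w v
form-sym v w = trans (form-coord v w) (trans (xorOver-cong swapTerms) (sym (form-coord w v)))
  where
  swapTerms : ∀ i → formTerm v w i ≡ formTerm w v i
  swapTerms i = trans (xor-comm (coord false v i ∧ coord true w i) (coord true v i ∧ coord false w i))
    (cong₂ _xor_ (∧-comm (coord true v i) (coord false w i)) (∧-comm (coord false v i) (coord true w i)))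

form-0Vˡ : (w : V n) → form 0V w ≡ false
form-0Vˡ w = trans (form-coord 0V w) (xorOver-zero _ λ i →
  cong₂ (λ a b → (a ∧ coord true w i) xor (b ∧ coord false w i)) (coord-0V false i) (coord-0V true i))

form-+Vˡ : (u v w : V n) → form (u +V v) w ≡ form u w xor form v w
form-+Vˡ u v w =
  trans (form-coord (u +V v) w)
    (trans (xorOver-cong term) (trans (xorOver-xor (formTerm u w) (formTerm v w))
      (sym (cong₂ _xor_ (form-coord u w) (form-coord v w)))))
  where
  term : ∀ i → formTerm (u +V v) w i ≡ formTerm u w i xor formTerm v w i
  term i rewrite coord-+V false u v i | coord-+V true u v i =
    trans (cong₂ _xor_ (∧-distribʳ-xor (coord true w i) (coord false u i) (coord false v i))
                       (∧-distribʳ-xor (coord false w i) (coord true u i) (coord true v i)))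
          (interchange (coord false u i ∧ coord true w i) (coord false v i ∧ coord true w i)
                       (coord true u i ∧ coord false w i) (coord true v i ∧ coord false w i))

form-·Vˡ : ∀ c (u w : V n) → form (c ·V u) w ≡ c ∧ form u w
form-·Vˡ c u w =
  trans (form-coord (c ·V u) w)
    (trans (xorOver-cong term) (trans (xorOver-∧ˡ c (formTerm u w)) (sym (cong (c ∧_) (form-coord u w)))))
  where
  term : ∀ i → formTerm (c ·V u) w i ≡ c ∧ formTerm u w i
  term i rewrite coord-·V false c u i | coord-·V true c u i =
    trans (cong₂ _xor_ (∧-assoc c (coord false u i) (coord true w i)) (∧-assoc c (coord true u i) (coord false w i)))
          (sym (∧-distribˡ-xor c _ _))

form-lincombˡ : ∀ (c : Fin k → Bool) (u : Fin k → V n) w →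
  form (lincomb c u) w ≡ xorOver (λ j → c j ∧ form (u j) w)
form-lincombˡ {zero} c u w = form-0Vˡ w
form-lincombˡ {suc k} c u w =
  trans (form-+Vˡ (c zero ·V u zero) (lincomb (c ∘ suc) (u ∘ suc)) w)
        (cong₂ _xor_ (form-·Vˡ (c zero) (u zero) w) (form-lincombˡ (c ∘ suc) (u ∘ suc) w))

Isotropic : (Fin k → V n) → Set
Isotropic u = ∀ i j → form (u i) (u j) ≡ false

lincomb-isotropic : (u : Fin k → V n) → Isotropic u → ∀ c d → form (lincomb c u) (lincomb d u) ≡ false
lincomb-isotropic u iso c d =
  trans (form-lincombˡ c u (lincomb d u)) (xorOver-zero _ λ i →
    trans (cong (c i ∧_) (trans (form-sym (u i) (lincomb d u))
      (trans (form-lincombˡ d u (u i)) (xorOver-zero _ λ j → trans (cong (d j ∧_) (iso j i)) (∧-zeroʳ (d j))))))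
    (∧-zeroʳ (c i)))

lincomb-closed : ∀ {L : SubsetV n} → IsSubspace L → (w : Fin k → V n) → (∀ j → L (w j) ≡ true) →
  ∀ c → L (lincomb c w) ≡ true
lincomb-closed {k = zero} (0∈L , _) w w∈L c = 0∈L
lincomb-closed {k = suc k} subspace@(_ , +-closed , ·-closed) w w∈L c =
  +-closed _ _ (·-closed (c zero) (w zero) (w∈L zero))
           (lincomb-closed subspace (w ∘ suc) (w∈L ∘ suc) (c ∘ suc))

lincomb-·V : ∀ a (c : Fin k → Bool) (b : Fin k → V n) → a ·V lincomb c b ≡ lincomb (λ j → a ∧ c j) b
lincomb-·V a c b = V-ext λ s i →
  trans (coord-·V s a (lincomb c b) i)
    (trans (cong (a ∧_) (coord-lincomb s c b i))
      (trans (sym (xorOver-∧ˡ a (λ j → c j ∧ coord s (b j) i)))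
        (trans (xorOver-cong (λ j → sym (∧-assoc a (c j) (coord s (b j) i)))) (sym (coord-lincomb s _ b i)))))

basis∈L : ∀ {L : SubsetV n} {b : Fin k → V n} → (∀ v → (L v ≡ true) ⇔ InSpan b v) → ∀ i → L (b i) ≡ true
basis∈L {b = b} spans i = Equivalence.from (spans (b i)) ((λ j → δ j i) , lincomb-δ b i)

span-isLagrangian : ∀ (L : SubsetV n) (b : Fin n → V n) → (∀ v → (L v ≡ true) ⇔ InSpan b v) →
  Isotropic b → (∀ c → lincomb c b ≡ 0V → ∀ i → c i ≡ false) → IsLagrangian L
span-isLagrangian L b spans isotropic independent =
  ( ∈L ((λ _ → false) , V-ext (λ s i → trans (coord-lincomb s _ b i)
                                              (trans (xorOver-zero (λ j → false ∧ coord s (b j) i) (λ _ → refl)) (sym (coord-0V s i)))))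
  , (λ u v u∈L v∈L → let (c , bc≡u) = ∈span u∈L ; (d , bd≡v) = ∈span v∈L in
       ∈L (_ , trans (sym (lincomb-xor c d b)) (cong₂ _+V_ bc≡u bd≡v)))
  , (λ a u u∈L → let (c , bc≡u) = ∈span u∈L in ∈L (_ , trans (sym (lincomb-·V a c b)) (cong (a ·V_) bc≡u))) )
  , (λ u v u∈L v∈L → let (c , bc≡u) = ∈span u∈L ; (d , bd≡v) = ∈span v∈L in
       subst₂ (λ x y → form x y ≡ false) bc≡u bd≡v (lincomb-isotropic b isotropic c d))
  , (b , independent , spans)
  where
  ∈L : ∀ {v} → InSpan b v → L v ≡ true
  ∈L {v} = Equivalence.from (spans v)
  ∈span : ∀ {v} → L v ≡ true → InSpan b v
  ∈span {v} = Equivalence.to (spans v)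

-- The coordinate subspaces W_Y = ⟨Y^∨ ⊔ (E ∖ Y)⟩

InW : Subset n → V n → Set
InW Y v = ∀ i → coord (not (lookup Y i)) v i ≡ false

coord-dualGens : ∀ s (Y : Subset n) k i → coord s (dualGens Y k) i ≡ not (s xor lookup Y k) ∧ δ k i
coord-dualGens s Y k i with lookup Y k
coord-dualGens false Y k i | false = lookup∘tabulate (δ k) i
coord-dualGens false Y k i | true = lookup-replicate i false
coord-dualGens true Y k i | false = lookup-replicate i false
coord-dualGens true Y k i | true = lookup∘tabulate (δ k) i

coord-lincomb-dualGens : ∀ s (c : Fin n → Bool) (Y : Subset n) i →
  coord s (lincomb c (dualGens Y)) i ≡ c i ∧ not (s xor lookup Y i)
coord-lincomb-dualGens s c Y i =
  trans (coord-lincomb s c (dualGens Y) i)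
    (trans (xorOver-cong (λ k → trans (cong (c k ∧_) (coord-dualGens s Y k i))
                                       (sym (∧-assoc (c k) (not (s xor lookup Y k)) (δ k i)))))
           (xorOver-∧δ (λ k → c k ∧ not (s xor lookup Y k)) i))

-- a vector of W_Y is its own expansion in the generators Y^∨ ⊔ (E ∖ Y)
InW-coord : ∀ (Y : Subset n) v → InW Y v →
  ∀ s i → coord (lookup Y i) v i ∧ not (s xor lookup Y i) ≡ coord s v i
InW-coord Y v v∈W s i with lookup Y i | v∈W i
... | false | v∨ᵢ≡0 = atSide s
  where
  atSide : ∀ s → coord false v i ∧ not (s xor false) ≡ coord s v i
  atSide false = ∧-identityʳ _
  atSide true = trans (∧-zeroʳ _) (sym v∨ᵢ≡0)
... | true | vᵢ≡0 = atSide s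
  where
  atSide : ∀ s → coord true v i ∧ not (s xor true) ≡ coord s v i
  atSide false = trans (∧-zeroʳ _) (sym vᵢ≡0)
  atSide true = ∧-identityʳ _

InSpan⇔InW : (Y : Subset n) (v : V n) → InSpan (dualGens Y) v ⇔ InW Y v
InSpan⇔InW Y v = mk⇔
  (λ { (c , refl) i → trans (coord-lincomb-dualGens (not (lookup Y i)) c Y i)
                        (trans (cong (c i ∧_) (not-xor-not (lookup Y i))) (∧-zeroʳ (c i))) })
  (λ v∈W → (λ i → coord (lookup Y i) v i) ,
           V-ext (λ s i → trans (coord-lincomb-dualGens s _ Y i) (InW-coord Y v v∈W s i)))
  where
  not-xor-not : ∀ y → not (not y xor y) ≡ false
  not-xor-not false = refl
  not-xor-not true = refl

InW-zero : ∀ (Y : Subset n) v → InW Y v → (∀ i → coord (lookup Y i) v i ≡ false) → v ≡ 0V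
InW-zero Y v v∈W vanish = V-ext λ s i →
  trans (sym (InW-coord Y v v∈W s i))
        (trans (cong (_∧ not (s xor lookup Y i)) (vanish i)) (sym (coord-0V s i)))

InW? : ∀ (Y : Subset n) v → Dec (InW Y v)
InW? Y v = all? (λ i → coord (not (lookup Y i)) v i Bool.≟ false)

form-InW : ∀ (Y : Subset n) v w → InW Y w →
  form v w ≡ xorOver (λ i → coord (not (lookup Y i)) v i ∧ coord (lookup Y i) w i)
form-InW Y v w w∈W = trans (form-coord v w) (xorOver-cong term)
  where
  term : ∀ i → formTerm v w i ≡ coord (not (lookup Y i)) v i ∧ coord (lookup Y i) w i
  term i with lookup Y i | w∈W i
  ... | false | w∨≡0 = cong (_xor (coord true v i ∧ coord false w i))
                             (trans (cong (coord false v i ∧_) w∨≡0) (∧-zeroʳ _))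
  ... | true | w≡0 = trans (cong (λ t → (coord false v i ∧ coord true w i) xor (coord true v i ∧ t)) w≡0)
                           (trans (cong ((coord false v i ∧ coord true w i) xor_) (∧-zeroʳ _)) (xor-identityʳ _))

Transversal : SubsetV n → Subset n → Set
Transversal L Y = ∀ v → L v ≡ true → InW Y v → v ≡ 0V

Ψ⇔Transversal : (L : SubsetV n) (Y : Subset n) → Ψ L Y ⇔ Transversal L Y
Ψ⇔Transversal L Y = mk⇔
  (λ ψ v v∈L v∈W → ψ v v∈L (Equivalence.from (InSpan⇔InW Y v) v∈W))
  (λ tr v v∈L v∈span → tr v v∈L (Equivalence.to (InSpan⇔InW Y v) v∈span))

-- Partial dualities: swap S exchanges e_i and e_i^∨ for i ∈ S

swap : Subset n → V n → V n
swap S v = tabulate (λ i → coord (lookup S i) v i) , tabulate (λ i → coord (not (lookup S i)) v i)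

coord-swap : ∀ s (S : Subset n) v i → coord s (swap S v) i ≡ coord (s xor lookup S i) v i
coord-swap false S v i = lookup∘tabulate _ i
coord-swap true S v i = lookup∘tabulate _ i

swap-involutive : ∀ (S : Subset n) v → swap S (swap S v) ≡ v
swap-involutive S v = V-ext λ s i →
  trans (coord-swap s S (swap S v) i)
        (trans (coord-swap (s xor lookup S i) S v i) (cong (λ t → coord t v i) (xor-cancelʳ s (lookup S i))))

swap-0V : (S : Subset n) → swap S 0V ≡ 0V
swap-0V S = V-ext λ s i → trans (coord-swap s S 0V i) (trans (coord-0V (s xor lookup S i) i) (sym (coord-0V s i)))

swap-+V : ∀ (S : Subset n) u v → swap S (u +V v) ≡ swap S u +V swap S v
swap-+V S u v = V-ext λ s i →
  trans (coord-swap s S (u +V v) i)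
    (trans (coord-+V (s xor lookup S i) u v i)
      (sym (trans (coord-+V s (swap S u) (swap S v) i) (cong₂ _xor_ (coord-swap s S u i) (coord-swap s S v i)))))

swap-·V : ∀ (S : Subset n) c v → swap S (c ·V v) ≡ c ·V swap S v
swap-·V S c v = V-ext λ s i →
  trans (coord-swap s S (c ·V v) i)
    (trans (coord-·V (s xor lookup S i) c v i) (sym (trans (coord-·V s c (swap S v) i) (cong (c ∧_) (coord-swap s S v i)))))

swap-lincomb : ∀ (S : Subset n) (c : Fin k → Bool) b → swap S (lincomb c b) ≡ lincomb c (swap S ∘ b)
swap-lincomb S c b = V-ext λ s i →
  trans (coord-swap s S (lincomb c b) i)
    (trans (coord-lincomb (s xor lookup S i) c b i)
      (sym (trans (coord-lincomb s c (swap S ∘ b) i)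
                  (xorOver-cong (λ j → cong (c j ∧_) (coord-swap s S (b j) i))))))

swap-≡0V : ∀ (S : Subset n) v → swap S v ≡ 0V → v ≡ 0V
swap-≡0V S v eq = trans (sym (swap-involutive S v)) (trans (cong (swap S) eq) (swap-0V S))

form-swap : ∀ (S : Subset n) u v → form (swap S u) (swap S v) ≡ form u v
form-swap S u v = trans (form-coord (swap S u) (swap S v)) (trans (xorOver-cong term) (sym (form-coord u v)))
  where
  term : ∀ i → formTerm (swap S u) (swap S v) i ≡ formTerm u v i
  term i rewrite coord-swap false S u i | coord-swap true S u i | coord-swap false S v i | coord-swap true S v i
    with lookup S i
  ... | false = refl
  ... | true = xor-comm (coord true u i ∧ coord false v i) (coord false u i ∧ coord true v i)

InW-swap : ∀ (X S : Subset n) v → InW (X Δ S) (swap S v) ⇔ InW X v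
InW-swap X S v = mk⇔ (λ w∈W i → trans (sym (term i)) (w∈W i)) (λ v∈W i → trans (term i) (v∈W i))
  where
  not-xor-cancelʳ : ∀ x s → not (x xor s) xor s ≡ not x
  not-xor-cancelʳ false false = refl
  not-xor-cancelʳ false true = refl
  not-xor-cancelʳ true false = refl
  not-xor-cancelʳ true true = refl
  term : ∀ i → coord (not (lookup (X Δ S) i)) (swap S v) i ≡ coord (not (lookup X i)) v i
  term i rewrite lookup-zipWith _xor_ i X S =
    trans (coord-swap (not (lookup X i xor lookup S i)) S v i) (cong (λ t → coord t v i) (not-xor-cancelʳ (lookup X i) (lookup S i)))

Transversal-swap : ∀ (L : SubsetV n) (X S : Subset n) → Transversal (L ∘ swap S) X ⇔ Transversal L (X Δ S)
Transversal-swap L X S = mk⇔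
  (λ tr w w∈L w∈W → trans (sym (swap-involutive S w)) (trans (cong (swap S)
     (tr (swap S w) (subst (λ u → L u ≡ true) (sym (swap-involutive S w)) w∈L)
         (Equivalence.to (InW-swap X S (swap S w)) (subst (InW (X Δ S)) (sym (swap-involutive S w)) w∈W))))
     (swap-0V S)))
  (λ tr v v∈L v∈W → swap-≡0V S v (tr (swap S v) v∈L (Equivalence.from (InW-swap X S v) v∈W)))

swap-isLagrangian : ∀ (S : Subset n) (L : SubsetV n) → IsLagrangian L → IsLagrangian (L ∘ swap S)
swap-isLagrangian S L (_ , isotropic , (b , independent , spans)) =
  span-isLagrangian (L ∘ swap S) (swap S ∘ b) spans′
    (λ i j → trans (form-swap S (b i) (b j)) (isotropic _ _ (basis∈L spans i) (basis∈L spans j)))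
    (λ c eq → independent c (swap-≡0V S _ (trans (swap-lincomb S c b) eq)))
  where
  spans′ : ∀ v → (L (swap S v) ≡ true) ⇔ InSpan (swap S ∘ b) v
  spans′ v = mk⇔
    (λ v∈L → let (c , eq) = Equivalence.to (spans (swap S v)) v∈L in
              c , trans (sym (swap-lincomb S c b)) (trans (cong (swap S) eq) (swap-involutive S v)))
    (λ { (c , eq) → Equivalence.from (spans (swap S v))
           (c , trans (sym (swap-involutive S _)) (cong (swap S) (trans (swap-lincomb S c b) eq))) })

lookupL-removeAt : ∀ {A : Set} (cs : List A) j j′ → ∃ λ j″ → lookupL (removeAt cs j) j′ ≡ lookupL cs j″
lookupL-removeAt (x ∷ xs) zero j′ = suc j′ , refl
lookupL-removeAt (x ∷ xs) (suc j) zero = zero , refl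
lookupL-removeAt (x ∷ xs) (suc j) (suc j′) = let (j″ , eq) = lookupL-removeAt xs j j′ in suc j″ , eq

lookupL-removeAt⁻ : ∀ {A : Set} (cs : List A) j₀ j → j ≢ j₀ → ∃ λ j′ → lookupL (removeAt cs j₀) j′ ≡ lookupL cs j
lookupL-removeAt⁻ (x ∷ xs) zero zero j≢j₀ = ⊥-elim (j≢j₀ refl)
lookupL-removeAt⁻ (x ∷ xs) zero (suc j) _ = j , refl
lookupL-removeAt⁻ (x ∷ xs) (suc j₀) zero _ = zero , refl
lookupL-removeAt⁻ (x ∷ xs) (suc j₀) (suc j) j≢j₀ =
  let (j′ , eq) = lookupL-removeAt⁻ xs j₀ j (j≢j₀ ∘ cong suc) in suc j′ , eq

length-removeAt : ∀ {A : Set} (cs : List A) j → suc (length (removeAt cs j)) ≡ length cs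
length-removeAt (x ∷ xs) zero = refl
length-removeAt (x ∷ xs) (suc j) = cong suc (length-removeAt xs j)

All-lookupL : ∀ {A : Set} {P : A → Set} {xs : List A} → All P xs → ∀ j → P (lookupL xs j)
All-lookupL (px ∷ pxs) zero = px
All-lookupL (px ∷ pxs) (suc j) = All-lookupL pxs j

All-removeAt : ∀ {A : Set} {P : A → Set} {xs : List A} → All P xs → ∀ j → All P (removeAt xs j)
All-removeAt (px ∷ pxs) zero = pxs
All-removeAt (px ∷ pxs) (suc j) = px ∷ All-removeAt pxs j

Unique-removeAt : ∀ {A : Set} {xs : List A} → Unique xs → ∀ j → Unique (removeAt xs j)
Unique-removeAt (x∉ ∷ uniq) zero = uniq
Unique-removeAt (x∉ ∷ uniq) (suc j) = All-removeAt x∉ j ∷ Unique-removeAt uniq j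

Unique-lookupL-injective : ∀ {A : Set} {xs : List A} → Unique xs → ∀ j j′ → lookupL xs j ≡ lookupL xs j′ → j ≡ j′
Unique-lookupL-injective (x∉ ∷ uniq) zero zero eq = refl
Unique-lookupL-injective (x∉ ∷ uniq) zero (suc j′) eq = ⊥-elim (All-lookupL x∉ j′ eq)
Unique-lookupL-injective (x∉ ∷ uniq) (suc j) zero eq = ⊥-elim (All-lookupL x∉ j (sym eq))
Unique-lookupL-injective (x∉ ∷ uniq) (suc j) (suc j′) eq = cong suc (Unique-lookupL-injective uniq j j′ eq)

lookupL-tabulate : ∀ {A : Set} m (f : Fin m → A) i → ∃ λ j → lookupL (Data.List.tabulate f) j ≡ f i
lookupL-tabulate (suc m) f zero = zero , refl
lookupL-tabulate (suc m) f (suc i) = let (j , eq) = lookupL-tabulate m (f ∘ suc) i in suc j , eq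

lookupL-allFin : ∀ m (i : Fin m) → ∃ λ j → lookupL (allFin m) j ≡ i
lookupL-allFin m = lookupL-tabulate m (λ i → i)

Row : ℕ → Set
Row n = Fin n → Bool

Matrix : ℕ → Set
Matrix n = Fin n → Fin n → Bool

VanishesOn : Row n → List (Fin n) → Set
VanishesOn x cs = ∀ j → x (lookupL cs j) ≡ false

comb : (Fin k → Bool) → (Fin k → Row n) → Row n
comb d v c = xorOver (λ i → d i ∧ v i c)

Independent : (Fin k → Row n) → List (Fin n) → Set
Independent v cs = ∀ d → VanishesOn (comb d v) cs → ∀ i → d i ≡ false

comb-insertAt : ∀ (d : Fin k → Bool) p t (v : Fin (suc k) → Row n) c →
  comb (insertAt d p t) v c ≡ (t ∧ v p c) xor comb d (v ∘ punchIn p) c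
comb-insertAt d p t v c =
  trans (xorOver-punchIn (λ i → insertAt d p t i ∧ v i c) p)
        (cong₂ _xor_ (cong (_∧ v p c) (insertAt-lookup d p t))
                     (xorOver-cong (λ l → cong (_∧ v (punchIn p l) c) (insertAt-punchIn d p t l))))

long⇒dependent : ∀ (cs : List (Fin n)) (v : Fin k → Row n) → length cs < k →
  ∃ λ d → (∃ λ i → d i ≡ true) × VanishesOn (comb d v) cs
long⇒dependent {k = suc k} [] v _ = (λ _ → true) , (zero , refl) , λ ()
long⇒dependent {n = n} {k = suc k} (c ∷ cs) v (s≤s |cs|<k) with allFalse-or-someTrue (λ i → v i c)
... | inj₁ column-c≡0 =
  let (d , nonzero , vanishes) = long⇒dependent cs v (m≤n⇒m≤1+n |cs|<k) in
  d , nonzero , λ { zero → xorOver-zero _ (λ i → trans (cong (d i ∧_) (column-c≡0 i)) (∧-zeroʳ (d i)))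
                  ; (suc j) → vanishes j }
... | inj₂ (p , vpc≡true) =
  let (d , (l , dl≡true) , vanishes) = long⇒dependent cs w |cs|<k in
  insertAt d p (t d) , (punchIn p l , trans (insertAt-punchIn d p (t d) l) dl≡true) ,
  λ { zero → trans (eliminated d c) (xorOver-zero _ (λ l → trans (cong (d l ∧_) (w-c l)) (∧-zeroʳ (d l))))
    ; (suc j) → trans (eliminated d (lookupL cs j)) (vanishes j) }
  where
  -- clear column c from the other rows using the pivot row p
  w : Fin k → Row n
  w l x = v (punchIn p l) x xor (v (punchIn p l) c ∧ v p x)
  w-c : ∀ l → w l c ≡ false
  w-c l rewrite vpc≡true = trans (cong (v (punchIn p l) c xor_) (∧-identityʳ _)) (xor-same (v (punchIn p l) c))
  t : (Fin k → Bool) → Bool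
  t d = comb d (v ∘ punchIn p) c
  eliminated : ∀ d x → comb (insertAt d p (t d)) v x ≡ comb d w x
  eliminated d x = begin
    comb (insertAt d p (t d)) v x
      ≡⟨ comb-insertAt d p (t d) v x ⟩
    (t d ∧ v p x) xor comb d (v ∘ punchIn p) x
      ≡⟨ xor-comm (t d ∧ v p x) _ ⟩
    comb d (v ∘ punchIn p) x xor (t d ∧ v p x)
      ≡⟨ cong (comb d (v ∘ punchIn p) x xor_) (sym (xorOver-∧ʳ (v p x) (λ l → d l ∧ v (punchIn p l) c))) ⟩
    comb d (v ∘ punchIn p) x xor xorOver (λ l → (d l ∧ v (punchIn p l) c) ∧ v p x)
      ≡⟨ cong (comb d (v ∘ punchIn p) x xor_) (xorOver-cong (λ l → ∧-assoc (d l) _ (v p x))) ⟩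
    comb d (v ∘ punchIn p) x xor xorOver (λ l → d l ∧ (v (punchIn p l) c ∧ v p x))
      ≡⟨ sym (xorOver-xor (λ l → d l ∧ v (punchIn p l) x) (λ l → d l ∧ (v (punchIn p l) c ∧ v p x))) ⟩
    xorOver (λ l → (d l ∧ v (punchIn p l) x) xor (d l ∧ (v (punchIn p l) c ∧ v p x)))
      ≡⟨ xorOver-cong (λ l → sym (∧-distribˡ-xor (d l) _ _)) ⟩
    comb d w x ∎
    where open ≡-Reasoning

independent⇒spanning : ∀ (cs : List (Fin n)) (v : Fin k → Row n) → length cs ≡ k → Independent v cs →
  ∀ y → ∃ λ e → ∀ j → comb e v (lookupL cs j) ≡ y (lookupL cs j)
independent⇒spanning cs v refl independent y
  with long⇒dependent cs (y ∷ᶠ v) ≤-refl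
... | e , (i , eᵢ≡true) , vanishes with e zero in e₀
...   | true = e ∘ suc , λ j → sym (xor≡false⇒≡ _ _ (vanishes j))
...   | false = ⊥-elim (zeroAt i eᵢ≡true)
  where
  tail≡0 : ∀ i → e (suc i) ≡ false
  tail≡0 = independent (e ∘ suc) vanishes
  zeroAt : ∀ i → e i ≡ true → ⊥
  zeroAt zero e₀≡true with trans (sym e₀) e₀≡true
  ... | ()
  zeroAt (suc i) eᵢ≡true with trans (sym (tail≡0 i)) eᵢ≡true
  ... | ()

laplace : Row n → (List (Fin n) → Bool) → List (Fin n) → Bool
laplace x g cs = xorOver (λ j → x (lookupL cs j) ∧ g (removeAt cs j))

laplace-xor : ∀ (x : Row n) g h cs → laplace x (λ L → g L xor h L) cs ≡ laplace x g cs xor laplace x h cs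
laplace-xor x g h cs =
  trans (xorOver-cong (λ j → ∧-distribˡ-xor (x (lookupL cs j)) (g (removeAt cs j)) (h (removeAt cs j))))
        (xorOver-xor (λ j → x (lookupL cs j) ∧ g (removeAt cs j)) (λ j → x (lookupL cs j) ∧ h (removeAt cs j)))

laplace-∧ : ∀ (x : Row n) a g cs → laplace x (λ L → a ∧ g L) cs ≡ a ∧ laplace x g cs
laplace-∧ x a g cs =
  trans (xorOver-cong (λ j → ∧-leftComm (x (lookupL cs j)) a (g (removeAt cs j))))
        (xorOver-∧ˡ a (λ j → x (lookupL cs j) ∧ g (removeAt cs j)))

laplace-zero : ∀ (x : Row n) g cs → (∀ L → g L ≡ false) → laplace x g cs ≡ false
laplace-zero x g cs g≡0 = xorOver-zero _ (λ j → trans (cong (x (lookupL cs j) ∧_) (g≡0 _)) (∧-zeroʳ _))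

-- expanding the first entry of the second row
laplace-cons : ∀ (x y : Row n) g c cs →
  laplace x (λ L → laplace y g (c ∷ L)) cs ≡ (y c ∧ laplace x g cs) xor laplace x (laplace y (g ∘ (c ∷_))) cs
laplace-cons x y g c cs =
  trans (laplace-xor x (λ L → y c ∧ g L) (laplace y (g ∘ (c ∷_))) cs)
        (cong (_xor laplace x (laplace y (g ∘ (c ∷_))) cs) (laplace-∧ x (y c) g cs))

laplace-comm : ∀ (x y : Row n) g cs → laplace x (laplace y g) cs ≡ laplace y (laplace x g) cs
laplace-comm x y g [] = refl
laplace-comm x y g (c ∷ cs) = begin
  (x c ∧ laplace y g cs) xor laplace x (λ L → laplace y g (c ∷ L)) cs
    ≡⟨ cong ((x c ∧ laplace y g cs) xor_) (laplace-cons x y g c cs) ⟩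
  (x c ∧ laplace y g cs) xor ((y c ∧ laplace x g cs) xor laplace x (laplace y (g ∘ (c ∷_))) cs)
    ≡⟨ cong (λ t → (x c ∧ laplace y g cs) xor ((y c ∧ laplace x g cs) xor t)) (laplace-comm x y (g ∘ (c ∷_)) cs) ⟩
  (x c ∧ laplace y g cs) xor ((y c ∧ laplace x g cs) xor laplace y (laplace x (g ∘ (c ∷_))) cs)
    ≡⟨ x∙yz≈y∙xz (x c ∧ laplace y g cs) (y c ∧ laplace x g cs) _ ⟩
  (y c ∧ laplace x g cs) xor ((x c ∧ laplace y g cs) xor laplace y (laplace x (g ∘ (c ∷_))) cs)
    ≡⟨ cong ((y c ∧ laplace x g cs) xor_) (sym (laplace-cons y x g c cs)) ⟩
  (y c ∧ laplace x g cs) xor laplace y (λ L → laplace x g (c ∷ L)) cs ∎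
  where open ≡-Reasoning

laplace-alternating : ∀ (x : Row n) g cs → laplace x (laplace x g) cs ≡ false
laplace-alternating x g [] = refl
laplace-alternating x g (c ∷ cs) =
  trans (cong ((x c ∧ laplace x g cs) xor_) (laplace-cons x x g c cs))
    (trans (sym (xor-assoc (x c ∧ laplace x g cs) _ _))
      (trans (cong (_xor laplace x (laplace x (g ∘ (c ∷_))) cs) (xor-same (x c ∧ laplace x g cs)))
             (laplace-alternating x (g ∘ (c ∷_)) cs)))

laplace-congʳ : ∀ (x y : Row n) g cs → (∀ j → x (lookupL cs j) ≡ y (lookupL cs j)) → laplace x g cs ≡ laplace y g cs
laplace-congʳ x y g cs x≡y = xorOver-cong (λ j → cong (_∧ g (removeAt cs j)) (x≡y j))

laplace-comb : ∀ (d : Fin k → Bool) (v : Fin k → Row n) g cs →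
  laplace (comb d v) g cs ≡ xorOver (λ i → d i ∧ laplace (v i) g cs)
laplace-comb d v g cs = begin
  xorOver (λ j → comb d v (lookupL cs j) ∧ g (removeAt cs j))
    ≡⟨ xorOver-cong (λ j → sym (xorOver-∧ʳ (g (removeAt cs j)) (λ i → d i ∧ v i (lookupL cs j)))) ⟩
  xorOver (λ j → xorOver (λ i → (d i ∧ v i (lookupL cs j)) ∧ g (removeAt cs j)))
    ≡⟨ xorOver-comm (λ j i → (d i ∧ v i (lookupL cs j)) ∧ g (removeAt cs j)) ⟩
  xorOver (λ i → xorOver (λ j → (d i ∧ v i (lookupL cs j)) ∧ g (removeAt cs j)))
    ≡⟨ xorOver-cong (λ i → trans (xorOver-cong (λ j → ∧-assoc (d i) (v i (lookupL cs j)) (g (removeAt cs j))))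
                                 (xorOver-∧ˡ (d i) (λ j → v i (lookupL cs j) ∧ g (removeAt cs j)))) ⟩
  xorOver (λ i → d i ∧ laplace (v i) g cs) ∎
  where open ≡-Reasoning

laplace-single : ∀ (cs : List (Fin n)) g → Unique cs → ∀ j₀ → laplace (δ (lookupL cs j₀)) g cs ≡ g (removeAt cs j₀)
laplace-single cs g unique j₀ =
  trans (xorOver-single _ j₀ (λ j j≢j₀ →
          cong (_∧ g (removeAt cs j)) (δ-≢ (λ eq → j≢j₀ (Unique-lookupL-injective unique j j₀ (sym eq))))))
        (cong (_∧ g (removeAt cs j₀)) (δ-refl (lookupL cs j₀)))

rowsOf : (A : Matrix n) (rs : List (Fin n)) → Fin (length rs) → Row n
rowsOf A rs i = A (lookupL rs i)

detSub-repeatedRow : ∀ (A : Matrix n) rs i cs → detSub A (lookupL rs i ∷ rs) cs ≡ false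
detSub-repeatedRow A (r ∷ rs) zero cs = laplace-alternating (A r) (detSub A rs) cs
detSub-repeatedRow A (r ∷ rs) (suc i) cs =
  trans (laplace-comm (A (lookupL rs i)) (A r) (detSub A rs) cs)
        (laplace-zero (A r) _ cs (detSub-repeatedRow A rs i))

xorOver-repeatedRows : ∀ (A : Matrix n) rs (e : Fin (length rs) → Bool) cs →
  xorOver (λ i → e i ∧ detSub A (lookupL rs i ∷ rs) cs) ≡ false
xorOver-repeatedRows A rs e cs =
  xorOver-zero _ (λ i → trans (cong (e i ∧_) (detSub-repeatedRow A rs i cs)) (∧-zeroʳ (e i)))

laplace-comb-rowsOf : ∀ (A : Matrix n) rs (e : Fin (length rs) → Bool) cs →
  laplace (comb e (rowsOf A rs)) (detSub A rs) cs ≡ false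
laplace-comb-rowsOf A rs e cs =
  trans (laplace-comb e (rowsOf A rs) (detSub A rs) cs) (xorOver-repeatedRows A rs e cs)

detSub-dependentRows : ∀ (A : Matrix n) rs cs d i → d i ≡ true →
  VanishesOn (comb d (rowsOf A rs)) cs → detSub A rs cs ≡ false
detSub-dependentRows A (r ∷ rs) cs d i dᵢ≡true vanishes with d zero in d₀
... | true = trans (laplace-congʳ (A r) (comb (d ∘ suc) (rowsOf A rs)) (detSub A rs) cs
                                 (λ j → xor≡false⇒≡ _ _ (vanishes j)))
                   (laplace-comb-rowsOf A rs (d ∘ suc) cs)
detSub-dependentRows A (r ∷ rs) cs d zero d₀≡true vanishes | false with trans (sym d₀) d₀≡true
... | ()
detSub-dependentRows A (r ∷ rs) cs d (suc i) dᵢ≡true vanishes | false =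
  xorOver-zero _ λ j → trans (cong (A r (lookupL cs j) ∧_)
    (detSub-dependentRows A rs (removeAt cs j) (d ∘ suc) i dᵢ≡true λ j′ →
      let (j″ , eq) = lookupL-removeAt cs j j′ in
      trans (cong (comb (d ∘ suc) (rowsOf A rs)) eq) (vanishes j″)))
    (∧-zeroʳ _)

detSub⇒independent : ∀ (A : Matrix n) rs cs → detSub A rs cs ≡ true → Independent (rowsOf A rs) cs
detSub⇒independent A rs cs det≡true d vanishes i with d i in dᵢ
... | false = refl
... | true with trans (sym det≡true) (detSub-dependentRows A rs cs d i dᵢ vanishes)
...   | ()

xorOver-columnRelation : ∀ (v : Fin k → Row n) cs (a : Fin (length cs) → Bool) →
  (∀ i → xorOver (λ j → a j ∧ v i (lookupL cs j)) ≡ false) →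
  ∀ d → xorOver (λ j → a j ∧ comb d v (lookupL cs j)) ≡ false
xorOver-columnRelation v cs a relation d = begin
  xorOver (λ j → a j ∧ xorOver (λ i → d i ∧ v i (lookupL cs j)))
    ≡⟨ xorOver-cong (λ j → sym (xorOver-∧ˡ (a j) (λ i → d i ∧ v i (lookupL cs j)))) ⟩
  xorOver (λ j → xorOver (λ i → a j ∧ (d i ∧ v i (lookupL cs j))))
    ≡⟨ xorOver-comm (λ j i → a j ∧ (d i ∧ v i (lookupL cs j))) ⟩
  xorOver (λ i → xorOver (λ j → a j ∧ (d i ∧ v i (lookupL cs j))))
    ≡⟨ xorOver-cong (λ i → trans (xorOver-cong (λ j → ∧-leftComm (a j) (d i) (v i (lookupL cs j))))
                                  (xorOver-∧ˡ (d i) (λ j → a j ∧ v i (lookupL cs j)))) ⟩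
  xorOver (λ i → d i ∧ xorOver (λ j → a j ∧ v i (lookupL cs j)))
    ≡⟨ xorOver-zero _ (λ i → trans (cong (d i ∧_) (relation i)) (∧-zeroʳ (d i))) ⟩
  false ∎
  where open ≡-Reasoning

independent-dropColumn : ∀ (A : Matrix n) r rs cs → length cs ≡ suc (length rs) →
  Independent (rowsOf A (r ∷ rs)) cs → ∃ λ j₀ → Independent (rowsOf A rs) (removeAt cs j₀)
independent-dropColumn A r rs cs |cs|≡1+|rs| independent
  with long⇒dependent (allFin (length rs)) (λ j i → rowsOf A rs i (lookupL cs j))
         (subst₂ _<_ (sym (length-tabulate (λ i → i))) (sym |cs|≡1+|rs|) ≤-refl)
... | a , (j₀ , aⱼ₀≡true) , a-vanishes = j₀ , tailIndependent
  where
  relation : ∀ i → xorOver (λ j → a j ∧ rowsOf A rs i (lookupL cs j)) ≡ false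
  relation i = let (i′ , eq) = lookupL-allFin (length rs) i in
    trans (cong (λ t → xorOver (λ j → a j ∧ rowsOf A rs t (lookupL cs j))) (sym eq)) (a-vanishes i′)
  tailIndependent : Independent (rowsOf A rs) (removeAt cs j₀)
  tailIndependent d vanishes i = independent (false ∷ᶠ d) u-vanishes (suc i)
    where
    u : Row _
    u = comb d (rowsOf A rs)
    u-vanishes′ : ∀ j → j ≢ j₀ → u (lookupL cs j) ≡ false
    u-vanishes′ j j≢j₀ = let (j′ , eq) = lookupL-removeAt⁻ cs j₀ j j≢j₀ in trans (cong u (sym eq)) (vanishes j′)
    u-vanishes : VanishesOn u cs
    u-vanishes j with j Fin.≟ j₀
    ... | no j≢j₀ = u-vanishes′ j j≢j₀
    ... | yes refl = trans (sym (cong (_∧ u (lookupL cs j₀)) aⱼ₀≡true))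
      (trans (sym (xorOver-single _ j₀ (λ j j≢j₀ → trans (cong (a j ∧_) (u-vanishes′ j j≢j₀)) (∧-zeroʳ (a j)))))
             (xorOver-columnRelation (rowsOf A rs) cs a relation d))

independent⇒detSub : ∀ (A : Matrix n) rs cs → length cs ≡ length rs → Unique cs →
  Independent (rowsOf A rs) cs → detSub A rs cs ≡ true
independent⇒detSub A [] cs _ _ _ = refl
independent⇒detSub A (r ∷ rs) cs |cs|≡|rs| unique independent =
  let (j₀ , tailIndependent) = independent-dropColumn A r rs cs |cs|≡|rs| independent
      (e , y≡e·rows) = independent⇒spanning cs (rowsOf A (r ∷ rs)) |cs|≡|rs| independent (δ (lookupL cs j₀))
      minor≡true = independent⇒detSub A rs (removeAt cs j₀)
                     (ℕ.suc-injective (trans (length-removeAt cs j₀) |cs|≡|rs|))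
                     (Unique-removeAt unique j₀) tailIndependent
  in ∧≡true⇒ʳ (e zero) _ (begin
    e zero ∧ detSub A (r ∷ rs) cs
      ≡⟨ sym (xor-identityʳ _) ⟩
    (e zero ∧ detSub A (r ∷ rs) cs) xor false
      ≡⟨ cong ((e zero ∧ detSub A (r ∷ rs) cs) xor_) (sym (xorOver-repeatedRows A rs (e ∘ suc) cs)) ⟩
    xorOver (λ i → e i ∧ laplace (rowsOf A (r ∷ rs) i) (detSub A rs) cs)
      ≡⟨ sym (laplace-comb e (rowsOf A (r ∷ rs)) (detSub A rs) cs) ⟩
    laplace (comb e (rowsOf A (r ∷ rs))) (detSub A rs) cs
      ≡⟨ laplace-congʳ (comb e (rowsOf A (r ∷ rs))) (δ (lookupL cs j₀)) (detSub A rs) cs y≡e·rows ⟩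
    laplace (δ (lookupL cs j₀)) (detSub A rs) cs
      ≡⟨ laplace-single cs (detSub A rs) unique j₀ ⟩
    detSub A rs (removeAt cs j₀)
      ≡⟨ minor≡true ⟩
    true ∎)
  where open ≡-Reasoning

Symmetric : Matrix n → Set
Symmetric B = ∀ i j → B i j ≡ B j i

matVec : Matrix n → Row n → Row n
matVec B z i = xorOver (λ j → B i j ∧ z j)

SupportedIn : Row n → Row n → Set
SupportedIn P z = ∀ i → P i ≡ false → z i ≡ false

-- the principal submatrix of B on the support of P has trivial kernel
NonSingularOn : Matrix n → Row n → Set
NonSingularOn B P = ∀ z → SupportedIn P z → (∀ i → P i ≡ true → matVec B z i ≡ false) → ∀ i → z i ≡ false

elems-member : ∀ (U : Subset n) xs k →
  lookup U (lookupL (Data.List.filter (λ i → lookup U i Bool.≟ true) xs) k) ≡ true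
elems-member U (x ∷ xs) k with lookup U x in Uₓ
elems-member U (x ∷ xs) zero | true = Uₓ
elems-member U (x ∷ xs) (suc k) | true = elems-member U xs k
... | false = elems-member U xs k

elems-complete : ∀ (U : Subset n) xs i → lookup U i ≡ true → (∃ λ k → lookupL xs k ≡ i) →
  ∃ λ k → lookupL (Data.List.filter (λ i → lookup U i Bool.≟ true) xs) k ≡ i
elems-complete U (x ∷ xs) i Uᵢ (k , xsₖ≡i) with lookup U x in Uₓ
elems-complete U (x ∷ xs) i Uᵢ (zero , refl) | true = zero , refl
elems-complete U (x ∷ xs) i Uᵢ (suc k , xsₖ≡i) | true =
  let (k′ , eq) = elems-complete U xs i Uᵢ (k , xsₖ≡i) in suc k′ , eq
elems-complete U (x ∷ xs) i Uᵢ (zero , refl) | false with trans (sym Uₓ) Uᵢ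
... | ()
elems-complete U (x ∷ xs) i Uᵢ (suc k , xsₖ≡i) | false = elems-complete U xs i Uᵢ (k , xsₖ≡i)

xorOver-filter : ∀ (U : Subset n) xs (h : Fin n → Bool) →
  xorOver (λ k → h (lookupL (Data.List.filter (λ i → lookup U i Bool.≟ true) xs) k))
    ≡ xorOver (λ k → lookup U (lookupL xs k) ∧ h (lookupL xs k))
xorOver-filter U [] h = refl
xorOver-filter U (x ∷ xs) h with lookup U x in Uₓ
... | true = cong (h x xor_) (xorOver-filter U xs h)
... | false = xorOver-filter U xs h

xorOver-tabulate : ∀ {A : Set} (f : Fin m → A) (h : A → Bool) →
  xorOver (λ k → h (lookupL (Data.List.tabulate f) k)) ≡ xorOver (h ∘ f)
xorOver-tabulate {zero} f h = refl
xorOver-tabulate {suc m} f h = cong (h (f zero) xor_) (xorOver-tabulate (f ∘ suc) h)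

xorOver-elems : ∀ (U : Subset n) (h : Fin n → Bool) →
  xorOver (λ k → h (lookupL (elems U) k)) ≡ xorOver (λ i → lookup U i ∧ h i)
xorOver-elems {n} U h =
  trans (xorOver-filter U (allFin n) h) (xorOver-tabulate (λ i → i) (λ i → lookup U i ∧ h i))

elems-unique : (U : Subset n) → Unique (elems U)
elems-unique {n} U = UniqueProperties.filter⁺ (λ i → lookup U i Bool.≟ true) (UniqueProperties.allFin⁺ n)

xorOver-supported : ∀ (P z x : Row n) → SupportedIn P z →
  xorOver (λ i → P i ∧ (z i ∧ x i)) ≡ xorOver (λ i → z i ∧ x i)
xorOver-supported P z x supported = xorOver-cong term
  where
  term : ∀ i → P i ∧ (z i ∧ x i) ≡ z i ∧ x i
  term i with z i in zᵢ | P i in Pᵢ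
  ... | false | p = ∧-zeroʳ p
  ... | true | true = refl
  ... | true | false with trans (sym zᵢ) (supported i Pᵢ)
  ...   | ()

module _ (A : Matrix n) (A-sym : Symmetric A) (U : Subset n) where

  independent⇒nonSingular : Independent (rowsOf A (elems U)) (elems U) → NonSingularOn A (lookup U)
  independent⇒nonSingular independent z supported kernel i with lookup U i in Uᵢ
  ... | false = supported i Uᵢ
  ... | true =
    let (k , eq) = elems-complete U (allFin n) i Uᵢ (lookupL-allFin n i) in
    trans (cong z (sym eq)) (independent (z ∘ lookupL (elems U)) vanishes k)
    where
    vanishes : VanishesOn (comb (z ∘ lookupL (elems U)) (rowsOf A (elems U))) (elems U)
    vanishes j = let c = lookupL (elems U) j in begin
      xorOver (λ k → z (lookupL (elems U) k) ∧ A (lookupL (elems U) k) c)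
        ≡⟨ xorOver-elems U (λ r → z r ∧ A r c) ⟩
      xorOver (λ r → lookup U r ∧ (z r ∧ A r c))
        ≡⟨ xorOver-supported (lookup U) z (λ r → A r c) supported ⟩
      xorOver (λ r → z r ∧ A r c)
        ≡⟨ xorOver-cong (λ r → trans (∧-comm (z r) (A r c)) (cong (_∧ z r) (A-sym r c))) ⟩
      matVec A z c
        ≡⟨ kernel c (elems-member U (allFin n) j) ⟩
      false ∎
      where open ≡-Reasoning

  nonSingular⇒independent : NonSingularOn A (lookup U) → Independent (rowsOf A (elems U)) (elems U)
  nonSingular⇒independent nonSingular d vanishes k₀ = trans (sym z-at-k₀) (z≡0 (lookupL (elems U) k₀))
    where
    -- z = Σₖ dₖ · e_{rₖ}, where r₀, r₁, … enumerate U
    z : Row n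
    z i = xorOver (λ k → d k ∧ δ (lookupL (elems U) k) i)
    supported : SupportedIn (lookup U) z
    supported i Uᵢ with z i in zᵢ
    ... | false = refl
    ... | true with xorOver-true (λ k → d k ∧ δ (lookupL (elems U) k) i) zᵢ
    ...   | k , dₖδ≡true with trans (sym Uᵢ) (subst (λ r → lookup U r ≡ true)
                                  (δ-true⇒≡ (∧≡true⇒ʳ (d k) _ dₖδ≡true)) (elems-member U (allFin n) k))
    ...     | ()
    kernel : ∀ i → lookup U i ≡ true → matVec A z i ≡ false
    kernel i Uᵢ = let (j , eq) = elems-complete U (allFin n) i Uᵢ (lookupL-allFin n i) in begin
      xorOver (λ j → A i j ∧ xorOver (λ k → d k ∧ δ (lookupL (elems U) k) j))
        ≡⟨ xorOver-cong (λ j → sym (xorOver-∧ˡ (A i j) (λ k → d k ∧ δ (lookupL (elems U) k) j))) ⟩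
      xorOver (λ j → xorOver (λ k → A i j ∧ (d k ∧ δ (lookupL (elems U) k) j)))
        ≡⟨ xorOver-comm (λ j k → A i j ∧ (d k ∧ δ (lookupL (elems U) k) j)) ⟩
      xorOver (λ k → xorOver (λ j → A i j ∧ (d k ∧ δ (lookupL (elems U) k) j)))
        ≡⟨ xorOver-cong (λ k → trans (xorOver-cong (λ j → ∧-leftComm (A i j) (d k) _))
             (trans (xorOver-∧ˡ (d k) (λ j → A i j ∧ δ (lookupL (elems U) k) j))
                    (cong (d k ∧_) (trans (xorOver-∧δ′ (A i) (lookupL (elems U) k)) (A-sym i _))))) ⟩
      comb d (rowsOf A (elems U)) i
        ≡⟨ cong (comb d (rowsOf A (elems U))) (sym eq) ⟩
      comb d (rowsOf A (elems U)) (lookupL (elems U) j)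
        ≡⟨ vanishes j ⟩
      false ∎
      where open ≡-Reasoning
    z≡0 : ∀ i → z i ≡ false
    z≡0 = nonSingular z supported kernel
    z-at-k₀ : z (lookupL (elems U) k₀) ≡ d k₀
    z-at-k₀ = trans (xorOver-single _ k₀ (λ k k≢k₀ → trans (cong (d k ∧_)
                       (δ-≢ (k≢k₀ ∘ Unique-lookupL-injective (elems-unique U) k k₀))) (∧-zeroʳ (d k))))
                    (trans (cong (d k₀ ∧_) (δ-refl (lookupL (elems U) k₀))) (∧-identityʳ (d k₀)))

  detSub-elems⇔nonSingular : (detSub A (elems U) (elems U) ≡ true) ⇔ NonSingularOn A (lookup U)
  detSub-elems⇔nonSingular = mk⇔
    (independent⇒nonSingular ∘ detSub⇒independent A (elems U) (elems U))
    (independent⇒detSub A (elems U) (elems U) refl (elems-unique U) ∘ nonSingular⇒independent)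

SpanTransversal : (Fin k → V n) → Subset n → Set
SpanTransversal u Y = ∀ c → InW Y (lincomb c u) → lincomb c u ≡ 0V

flip : Subset n → Fin n → Subset n
flip Y i = tabulate (λ j → lookup Y j xor δ i j)

InW-flip : ∀ (Y : Subset n) i v → InW (flip Y i) v →
  coord (lookup Y i) v i ≡ false × (∀ j → j ≢ i → coord (not (lookup Y j)) v j ≡ false)
InW-flip Y i v v∈W = trans (cong (λ t → coord t v i) (flipped (lookup Y i)))
                             (trans (cong (λ t → coord (not (lookup Y i xor t)) v i) (sym (δ-refl i))) (atFlip i))
                   , λ j j≢i → trans (cong (λ t → coord (not t) v j) (sym (unflipped j j≢i))) (atFlip j)
  where
  atFlip : ∀ j → coord (not (lookup Y j xor δ i j)) v j ≡ false
  atFlip j = trans (cong (λ t → coord (not t) v j) (sym (lookup∘tabulate _ j))) (v∈W j)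
  flipped : ∀ y → y ≡ not (y xor true)
  flipped false = refl
  flipped true = refl
  unflipped : ∀ j → j ≢ i → lookup Y j xor δ i j ≡ lookup Y j
  unflipped j j≢i = trans (cong (lookup Y j xor_) (δ-≢ (j≢i ∘ sym))) (xor-identityʳ _)

-- If span(u ∘ suc) is transversal to W_Y but some w ∈ span u ∩ W_Y has coordinate i on the W_Y side,
-- flipping i makes span u transversal: isotropy against w forbids the other coordinate at i.
module _ (u : Fin (suc k) → V n) (isotropic : Isotropic u) (Y : Subset n)
         (tailTransversal : SpanTransversal (u ∘ suc) Y)
         (c₀ : Fin (suc k) → Bool) (i : Fin n) (w∈W : InW Y (lincomb c₀ u))
         (wᵢ≡true : coord (lookup Y i) (lincomb c₀ u) i ≡ true) where

  private
    headless⇒zero : ∀ d → d zero ≡ false → InW Y (lincomb d u) → lincomb d u ≡ 0V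
    headless⇒zero d d₀ d∈W = trans (lincomb-tail d u d₀)
      (tailTransversal (d ∘ suc) (subst (InW Y) (lincomb-tail d u d₀) d∈W))

    nonzeroAt-i : ∀ d → InW Y (lincomb d u) → coord (lookup Y i) (lincomb d u) i ≡ true → d zero ≡ true
    nonzeroAt-i d d∈W dᵢ≡true = ¬-not λ d₀ → true≢false (trans (sym dᵢ≡true)
      (trans (cong (λ x → coord (lookup Y i) x i) (headless⇒zero d d₀ d∈W)) (coord-0V (lookup Y i) i)))

    InW-unflip : ∀ c → InW (flip Y i) (lincomb c u) → InW Y (lincomb c u)
    InW-unflip c v∈W′ j with j Fin.≟ i | coord (not (lookup Y i)) (lincomb c u) i in v′ᵢ
    ... | no j≢i | _ = proj₂ (InW-flip Y i (lincomb c u) v∈W′) j j≢i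
    ... | yes refl | false = v′ᵢ
    ... | yes refl | true = ⊥-elim (true≢false (trans (sym form≡true) (lincomb-isotropic u isotropic c c₀)))
      where
      form≡true : form (lincomb c u) (lincomb c₀ u) ≡ true
      form≡true = trans (form-InW Y (lincomb c u) (lincomb c₀ u) w∈W)
        (trans (xorOver-single _ i (λ j j≢i → cong (_∧ coord (lookup Y j) (lincomb c₀ u) j)
                                                (proj₂ (InW-flip Y i (lincomb c u) v∈W′) j j≢i)))
               (cong₂ _∧_ v′ᵢ wᵢ≡true))

  spanTransversal-flip : SpanTransversal u (flip Y i)
  spanTransversal-flip c v∈W′ with c zero Bool.≟ false
  ... | yes c₀′ = headless⇒zero c c₀′ (InW-unflip c v∈W′)
  ... | no c₀′ = ⊥-elim (true≢false (trans (sym (nonzeroAt-i (λ j → c j xor c₀ j) sum∈W sumᵢ≡true)) cancel))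
    where
    cancel : c zero xor c₀ zero ≡ false
    cancel = trans (cong₂ _xor_ (¬-not c₀′) (nonzeroAt-i c₀ w∈W wᵢ≡true)) refl
    -- v + w lies in span(u ∘ suc) ∩ W_Y yet has coordinate i on the W_Y side
    sum∈W : InW Y (lincomb (λ j → c j xor c₀ j) u)
    sum∈W j = trans (cong (λ x → coord (not (lookup Y j)) x j) (sym (lincomb-xor c c₀ u)))
      (trans (coord-+V (not (lookup Y j)) (lincomb c u) (lincomb c₀ u) j) (cong₂ _xor_ (InW-unflip c v∈W′ j) (w∈W j)))
    sumᵢ≡true : coord (lookup Y i) (lincomb (λ j → c j xor c₀ j) u) i ≡ true
    sumᵢ≡true = trans (cong (λ x → coord (lookup Y i) x i) (sym (lincomb-xor c c₀ u)))
      (trans (coord-+V (lookup Y i) (lincomb c u) (lincomb c₀ u) i)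
             (cong₂ _xor_ (proj₁ (InW-flip Y i (lincomb c u) v∈W′)) wᵢ≡true))

isotropic⇒spanTransversal : ∀ (u : Fin k → V n) → Isotropic u → ∃ (SpanTransversal u)
isotropic⇒spanTransversal {zero} {n} u _ = replicate n false , λ c _ → refl
isotropic⇒spanTransversal {suc k} u isotropic
  with isotropic⇒spanTransversal (u ∘ suc) (λ i j → isotropic (suc i) (suc j))
... | Y , tailTransversal
  with anySubset? (λ c → InW? Y (lincomb (lookup c) u)
                         ×-dec any? (λ i → coord (lookup Y i) (lincomb (lookup c) u) i Bool.≟ true))
...   | yes (c₀ , w∈W , i , wᵢ≡true) =
  flip Y i , spanTransversal-flip u isotropic Y tailTransversal (lookup c₀) i w∈W wᵢ≡true
...   | no none = Y , λ c v∈W → InW-zero Y _ v∈W λ i → ¬-not λ vᵢ≡true →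
  let same = lincomb-cong u (lookup∘tabulate c) in
  none (tabulate c , subst (InW Y) (sym same) v∈W ,
        i , trans (cong (λ x → coord (lookup Y i) x i) same) vᵢ≡true)

lagrangian⇒transversal : (L : SubsetV n) → IsLagrangian L → ∃ (Transversal L)
lagrangian⇒transversal L (_ , isotropic , (b , _ , spans)) =
  let (Y , transversal) = isotropic⇒spanTransversal b (λ i j → isotropic _ _ (basis∈L spans i) (basis∈L spans j)) in
  Y , λ v v∈L v∈W → let (c , bc≡v) = Equivalence.to (spans v) v∈L in
      trans (sym bc≡v) (transversal c (subst (InW Y) (sym bc≡v) v∈W))

graphPoint : Matrix n → Row n → V n
graphPoint B z = tabulate (matVec B z) , tabulate z

OnGraph : Matrix n → V n → Set
OnGraph B v = ∀ i → coord false v i ≡ matVec B (coord true v) i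

IsGraph : SubsetV n → Matrix n → Set
IsGraph L B = ∀ v → (L v ≡ true) ⇔ OnGraph B v

matVec-cong : ∀ (B : Matrix n) {z z′} → (∀ j → z j ≡ z′ j) → ∀ i → matVec B z i ≡ matVec B z′ i
matVec-cong B z≗z′ i = xorOver-cong (λ j → cong (B i j ∧_) (z≗z′ j))

matVec-zero : ∀ (B : Matrix n) z → (∀ j → z j ≡ false) → ∀ i → matVec B z i ≡ false
matVec-zero B z z≡0 i = xorOver-zero _ (λ j → trans (cong (B i j ∧_) (z≡0 j)) (∧-zeroʳ (B i j)))

onGraph-graphPoint : ∀ (B : Matrix n) z → OnGraph B (graphPoint B z)
onGraph-graphPoint B z i =
  trans (lookup∘tabulate (matVec B z) i) (matVec-cong B (λ j → sym (lookup∘tabulate z j)) i)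

onGraph⇒graphPoint : ∀ (B : Matrix n) v → OnGraph B v → v ≡ graphPoint B (coord true v)
onGraph⇒graphPoint B v onGraph = V-ext λ
  { false i → trans (onGraph i) (sym (lookup∘tabulate _ i))
  ; true i → sym (lookup∘tabulate _ i) }

lincomb-graphColumns : ∀ (B : Matrix n) (u : Fin n → V n) → (∀ j → u j ≡ graphPoint B (δ j)) →
  ∀ z → lincomb z u ≡ graphPoint B z
lincomb-graphColumns B u columns z = V-ext λ s i →
  trans (coord-lincomb s z u i) (trans (xorOver-cong (λ j → cong (λ x → z j ∧ coord s x i) (columns j))) (term s i))
  where
  term : ∀ s i → xorOver (λ j → z j ∧ coord s (graphPoint B (δ j)) i) ≡ coord s (graphPoint B z) i
  term false i = begin
    xorOver (λ j → z j ∧ lookup (tabulate (matVec B (δ j))) i)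
      ≡⟨ xorOver-cong (λ j → cong (z j ∧_) (trans (lookup∘tabulate _ i) (xorOver-∧δ′ (B i) j))) ⟩
    xorOver (λ j → z j ∧ B i j)
      ≡⟨ xorOver-cong (λ j → ∧-comm (z j) (B i j)) ⟩
    matVec B z i
      ≡⟨ sym (lookup∘tabulate _ i) ⟩
    lookup (tabulate (matVec B z)) i ∎
    where open ≡-Reasoning
  term true i = trans (xorOver-cong (λ j → cong (z j ∧_) (trans (lookup∘tabulate (δ j) i) (δ-sym j i))))
                      (trans (xorOver-∧δ′ z i) (sym (lookup∘tabulate z i)))

transversal⇔nonSingular : ∀ (L : SubsetV n) (B : Matrix n) → IsGraph L B →
  ∀ Y → Transversal L Y ⇔ NonSingularOn B (lookup Y)
transversal⇔nonSingular L B isGraph Y = mk⇔ ⇒ ⇐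
  where
  ⇒ : Transversal L Y → NonSingularOn B (lookup Y)
  ⇒ transversal z supported kernel i =
    trans (sym (lookup∘tabulate z i)) (trans (cong (λ x → coord true x i) v≡0) (coord-0V true i))
    where
    v∈W : InW Y (graphPoint B z)
    v∈W i with lookup Y i in Yᵢ
    ... | true = trans (lookup∘tabulate (matVec B z) i) (kernel i Yᵢ)
    ... | false = trans (lookup∘tabulate z i) (supported i Yᵢ)
    v≡0 : graphPoint B z ≡ 0V
    v≡0 = transversal _ (Equivalence.from (isGraph _) (onGraph-graphPoint B z)) v∈W
  ⇐ : NonSingularOn B (lookup Y) → Transversal L Y
  ⇐ nonSingular v v∈L v∈W = V-ext λ
    { false i → trans (onGraph i) (trans (matVec-zero B _ z≡0 i) (sym (coord-0V false i)))
    ; true i → trans (z≡0 i) (sym (coord-0V true i)) }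
    where
    onGraph : OnGraph B v
    onGraph = Equivalence.to (isGraph v) v∈L
    z≡0 : ∀ i → coord true v i ≡ false
    z≡0 = nonSingular (coord true v) supported kernel
      where
      supported : SupportedIn (lookup Y) (coord true v)
      supported i Yᵢ = subst (λ y → coord (not y) v i ≡ false) Yᵢ (v∈W i)
      kernel : ∀ i → lookup Y i ≡ true → matVec B (coord true v) i ≡ false
      kernel i Yᵢ = trans (sym (onGraph i)) (subst (λ y → coord (not y) v i ≡ false) Yᵢ (v∈W i))

matVec-δ : ∀ (B : Matrix n) j i → matVec B (δ j) i ≡ B i j
matVec-δ B j i = xorOver-∧δ′ (B i) j

form-graphColumns : ∀ (B : Matrix n) i j → form (graphPoint B (δ i)) (graphPoint B (δ j)) ≡ B j i xor B i j
form-graphColumns B i j = begin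
  form (graphPoint B (δ i)) (graphPoint B (δ j))
    ≡⟨ form-coord (graphPoint B (δ i)) (graphPoint B (δ j)) ⟩
  xorOver (formTerm (graphPoint B (δ i)) (graphPoint B (δ j)))
    ≡⟨ xorOver-cong (λ k → cong₂ _xor_
         (cong₂ _∧_ (trans (lookup∘tabulate _ k) (matVec-δ B i k)) (lookup∘tabulate (δ j) k))
         (cong₂ _∧_ (lookup∘tabulate (δ i) k) (trans (lookup∘tabulate _ k) (matVec-δ B j k)))) ⟩
  xorOver (λ k → (B k i ∧ δ j k) xor (δ i k ∧ B k j))
    ≡⟨ xorOver-xor (λ k → B k i ∧ δ j k) (λ k → δ i k ∧ B k j) ⟩
  xorOver (λ k → B k i ∧ δ j k) xor xorOver (λ k → δ i k ∧ B k j)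
    ≡⟨ cong₂ _xor_ (xorOver-∧δ′ (λ k → B k i) j)
                   (trans (xorOver-cong (λ k → ∧-comm (δ i k) (B k j))) (xorOver-∧δ′ (λ k → B k j) i)) ⟩
  B j i xor B i j ∎
  where open ≡-Reasoning

onGraph? : ∀ (B : Matrix n) v → Dec (OnGraph B v)
onGraph? B v = all? (λ i → coord false v i Bool.≟ matVec B (coord true v) i)

graph : Matrix n → SubsetV n
graph B v = does (onGraph? B v)

graph-isGraph : (B : Matrix n) → IsGraph (graph B) B
graph-isGraph B v = mk⇔ (does⇒ (onGraph? B v)) (⇒does (onGraph? B v))
  where
  does⇒ : ∀ {A : Set} (a? : Dec A) → does a? ≡ true → A
  does⇒ (yes a) _ = a
  ⇒does : ∀ {A : Set} (a? : Dec A) → A → does a? ≡ true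
  ⇒does (yes _) _ = refl
  ⇒does (no ¬a) a = ⊥-elim (¬a a)

graph-isLagrangian : (B : Matrix n) → Symmetric B → IsLagrangian (graph B)
graph-isLagrangian {n} B B-sym = span-isLagrangian (graph B) columns spans isotropic independent
  where
  columns : Fin n → V n
  columns j = graphPoint B (δ j)
  lincomb≡graphPoint : ∀ z → lincomb z columns ≡ graphPoint B z
  lincomb≡graphPoint = lincomb-graphColumns B columns (λ j → refl)
  spans : ∀ v → (graph B v ≡ true) ⇔ InSpan columns v
  spans v = mk⇔
    (λ v∈graph → coord true v , trans (lincomb≡graphPoint _)
                                      (sym (onGraph⇒graphPoint B v (Equivalence.to (graph-isGraph B v) v∈graph))))
    (λ { (z , refl) → Equivalence.from (graph-isGraph B (lincomb z columns))
                        (subst (OnGraph B) (sym (lincomb≡graphPoint z)) (onGraph-graphPoint B z)) })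
  isotropic : Isotropic columns
  isotropic i j = trans (form-graphColumns B i j) (trans (cong (_xor B i j) (B-sym j i)) (xor-same (B i j)))
  independent : ∀ z → lincomb z columns ≡ 0V → ∀ i → z i ≡ false
  independent z eq i = trans (sym (lookup∘tabulate z i))
    (trans (cong (λ x → coord true x i) (trans (sym (lincomb≡graphPoint z)) eq)) (coord-0V true i))

-- A Lagrangian transversal to W_∅ = ⟨E⟩ projects isomorphically onto ⟨E^∨⟩, so it is a graph.
transversal∅⇒graph : ∀ (L : SubsetV n) → IsLagrangian L → Transversal L ∅ → ∃ λ B → Symmetric B × IsGraph L B
transversal∅⇒graph {n} L (subspace , isotropic , (b , independent , spans)) transversal = B , B-sym , isGraph
  where
  InW-∅ : ∀ v → (∀ i → coord true v i ≡ false) → InW ∅ v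
  InW-∅ v v∨≡0 i rewrite lookup-replicate i false = v∨≡0 i
  dualParts : Fin n → Row n
  dualParts k = coord true (b k)
  dualParts-independent : Independent dualParts (allFin n)
  dualParts-independent d vanishes = independent d (transversal _ (Equivalence.from (spans _) (d , refl))
    (InW-∅ _ λ j → let (j′ , eq) = lookupL-allFin n j in
      trans (coord-lincomb true d b j) (trans (cong (comb d dualParts) (sym eq)) (vanishes j′))))
  preimage : ∀ j → ∃ λ c → ∀ k → coord true (lincomb c b) k ≡ δ j k
  preimage j =
    let (c , spanned) = independent⇒spanning (allFin n) dualParts (length-tabulate (λ i → i))
                                              dualParts-independent (δ j) in
    c , λ k → let (k′ , eq) = lookupL-allFin n k in
      trans (coord-lincomb true c b k)
            (trans (cong (comb c dualParts) (sym eq)) (trans (spanned k′) (cong (δ j) eq)))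
  u : Fin n → V n
  u j = lincomb (proj₁ (preimage j)) b
  u∈L : ∀ j → L (u j) ≡ true
  u∈L j = Equivalence.from (spans (u j)) (_ , refl)
  B : Matrix n
  B i j = coord false (u j) i
  u≡column : ∀ j → u j ≡ graphPoint B (δ j)
  u≡column j = V-ext λ
    { false i → trans (sym (matVec-δ B j i)) (sym (lookup∘tabulate _ i))
    ; true i → trans (proj₂ (preimage j) i) (sym (lookup∘tabulate (δ j) i)) }
  graphPoint∈L : ∀ z → L (graphPoint B z) ≡ true
  graphPoint∈L z = subst (λ x → L x ≡ true) (lincomb-graphColumns B u u≡column z) (lincomb-closed subspace u u∈L z)
  B-sym : Symmetric B
  B-sym i j = sym (xor≡false⇒≡ _ _ (trans (sym (trans (cong₂ form (u≡column i) (u≡column j)) (form-graphColumns B i j)))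
                                          (isotropic (u i) (u j) (u∈L i) (u∈L j))))
  isGraph : IsGraph L B
  isGraph v = mk⇔ onGraph (λ onGraph → subst (λ x → L x ≡ true) (sym (onGraph⇒graphPoint B v onGraph)) (graphPoint∈L _))
    where
    w : V n
    w = v +V graphPoint B (coord true v)
    w≡0 : L v ≡ true → w ≡ 0V
    w≡0 v∈L = transversal w (proj₁ (proj₂ subspace) _ _ v∈L (graphPoint∈L _))
      (InW-∅ w λ i → trans (coord-+V true v (graphPoint B (coord true v)) i)
                       (trans (cong (coord true v i xor_) (lookup∘tabulate (coord true v) i)) (xor-same (coord true v i))))
    onGraph : L v ≡ true → OnGraph B v
    onGraph v∈L i = trans (xor≡false⇒≡ _ _ (trans (sym (coord-+V false v (graphPoint B (coord true v)) i))
                            (trans (cong (λ x → coord false x i) (w≡0 v∈L)) (coord-0V false i))))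
                          (lookup∘tabulate _ i)

-- Recovering a symmetric matrix from its principal minors of size ≤ 2

nonSingular₂ : ∀ a b c x y → (a ∧ b) xor c ≡ true →
  (a ∧ x) xor (c ∧ y) ≡ false → (c ∧ x) xor (b ∧ y) ≡ false → x ≡ false × y ≡ false
nonSingular₂ false false false x y ()
nonSingular₂ false false true false false _ _ _ = refl , refl
nonSingular₂ false false true false true _ () _
nonSingular₂ false false true true false _ _ ()
nonSingular₂ false false true true true _ () _
nonSingular₂ false true false x y ()
nonSingular₂ false true true false false _ _ _ = refl , refl
nonSingular₂ false true true false true _ () _
nonSingular₂ false true true true false _ _ ()
nonSingular₂ false true true true true _ () _
nonSingular₂ true false false x y ()
nonSingular₂ true false true false false _ _ _ = refl , refl
nonSingular₂ true false true false true _ () _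
nonSingular₂ true false true true false _ () _
nonSingular₂ true false true true true _ _ ()
nonSingular₂ true true false false false _ _ _ = refl , refl
nonSingular₂ true true false false true _ _ ()
nonSingular₂ true true false true false _ () _
nonSingular₂ true true false true true _ () _
nonSingular₂ true true true x y ()

singular₂ : ∀ a b c → (a ∧ b) xor c ≡ false →
  ∃ λ x → ∃ λ y → x ∨ y ≡ true × (a ∧ x) xor (c ∧ y) ≡ false × (c ∧ x) xor (b ∧ y) ≡ false
singular₂ false false false _ = true , false , refl , refl , refl
singular₂ false true false _ = true , false , refl , refl , refl
singular₂ true false false _ = false , true , refl , refl , refl
singular₂ true true true _ = true , true , refl , refl , refl
singular₂ false false true ()
singular₂ false true true ()
singular₂ true false true ()
singular₂ true true false ()

nonSingular-single : ∀ (B : Matrix n) i → NonSingularOn B (δ i) ⇔ (B i i ≡ true)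
nonSingular-single B i = mk⇔ ⇒ ⇐
  where
  ⇐ : B i i ≡ true → NonSingularOn B (δ i)
  ⇐ Bᵢᵢ z supported kernel k with i Fin.≟ k
  ... | no i≢k = supported k (δ-≢ i≢k)
  ... | yes refl = trans (sym Bz≡z) (kernel i (δ-refl i))
    where
    Bz≡z : matVec B z i ≡ z i
    Bz≡z = trans (xorOver-single _ i (λ j j≢i → trans (cong (B i j ∧_) (supported j (≢⇒δ≡false j≢i))) (∧-zeroʳ _)))
                 (cong (_∧ z i) Bᵢᵢ)
  ⇒ : NonSingularOn B (δ i) → B i i ≡ true
  ⇒ nonSingular = ¬-not λ Bᵢᵢ → true≢false (trans (sym (δ-refl i)) (nonSingular (δ i) (λ _ δ≡0 → δ≡0) (kernel Bᵢᵢ) i))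
    where
    kernel : B i i ≡ false → ∀ k → δ i k ≡ true → matVec B (δ i) k ≡ false
    kernel Bᵢᵢ k δᵢₖ with δ-true⇒≡ {i = i} {j = k} δᵢₖ
    ... | refl = trans (matVec-δ B i i) Bᵢᵢ

pairSet : Fin n → Fin n → Row n
pairSet i j k = δ i k ∨ δ j k

module _ {i j : Fin n} (i≢j : i ≢ j) where

  pairSet-outside : ∀ l → l ≢ i → l ≢ j → pairSet i j l ≡ false
  pairSet-outside l l≢i l≢j rewrite ≢⇒δ≡false {i = i} l≢i | ≢⇒δ≡false {i = j} l≢j = refl

  pairSet-left : pairSet i j i ≡ true
  pairSet-left rewrite δ-refl i = refl

  pairSet-right : pairSet i j j ≡ true
  pairSet-right rewrite δ-refl j | δ-≢ i≢j = refl

  xorOver-pair : (f : Fin n → Bool) → (∀ l → l ≢ i → l ≢ j → f l ≡ false) → xorOver f ≡ f i xor f j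
  xorOver-pair f f≡0 =
    trans (xorOver-cong split)
      (trans (xorOver-xor (λ l → f l ∧ δ i l) (λ l → f l ∧ δ j l)) (cong₂ _xor_ (xorOver-∧δ′ f i) (xorOver-∧δ′ f j)))
    where
    split : ∀ l → f l ≡ (f l ∧ δ i l) xor (f l ∧ δ j l)
    split l with l Fin.≟ i | l Fin.≟ j
    ... | yes refl | _ rewrite δ-refl l | ≢⇒δ≡false {i = j} {j = l} i≢j =
      sym (trans (cong (_xor (f l ∧ false)) (∧-identityʳ (f l)))
                 (trans (cong (f l xor_) (∧-zeroʳ (f l))) (xor-identityʳ (f l))))
    ... | no _ | yes refl rewrite δ-refl l | ≢⇒δ≡false {i = i} {j = l} (i≢j ∘ sym) =
      sym (trans (cong ((f l ∧ false) xor_) (∧-identityʳ (f l))) (cong (_xor f l) (∧-zeroʳ (f l))))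
    ... | no l≢i | no l≢j rewrite f≡0 l l≢i l≢j = refl

  pairSet-member : ∀ {k} → pairSet i j k ≡ true → k ≡ i ⊎ k ≡ j
  pairSet-member {k} k∈pair with k Fin.≟ i
  ... | yes k≡i = inj₁ k≡i
  ... | no k≢i = inj₂ (sym (δ-true⇒≡ (subst (λ b → b ∨ δ j k ≡ true) (≢⇒δ≡false k≢i) k∈pair)))

  pairVector : Bool → Bool → Row n
  pairVector x y k = (x ∧ δ i k) xor (y ∧ δ j k)

  pairVector-left : ∀ x y → pairVector x y i ≡ x
  pairVector-left x y rewrite δ-refl i | δ-≢ (i≢j ∘ sym) =
    trans (cong₂ _xor_ (∧-identityʳ x) (∧-zeroʳ y)) (xor-identityʳ x)

  pairVector-right : ∀ x y → pairVector x y j ≡ y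
  pairVector-right x y rewrite δ-refl j | δ-≢ i≢j = cong₂ _xor_ (∧-zeroʳ x) (∧-identityʳ y)

  pairVector-supported : ∀ x y → SupportedIn (pairSet i j) (pairVector x y)
  pairVector-supported x y l l∉pair with δ i l | δ j l
  ... | false | false = cong₂ _xor_ (∧-zeroʳ x) (∧-zeroʳ y)
  ... | true | _ with l∉pair
  ...   | ()
  pairVector-supported x y l l∉pair | false | true with l∉pair
  ...   | ()

module _ (B : Matrix n) (B-sym : Symmetric B) {i j : Fin n} (i≢j : i ≢ j) where

  matVec-pair : ∀ z → SupportedIn (pairSet i j) z → ∀ k → matVec B z k ≡ (B k i ∧ z i) xor (B k j ∧ z j)
  matVec-pair z supported k =
    xorOver-pair i≢j (λ l → B k l ∧ z l)
      (λ l l≢i l≢j → trans (cong (B k l ∧_) (supported l (pairSet-outside i≢j l l≢i l≢j))) (∧-zeroʳ _))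

  kernel-pair : ∀ z → SupportedIn (pairSet i j) z →
    (matVec B z i ≡ (B i i ∧ z i) xor (B i j ∧ z j)) × (matVec B z j ≡ (B i j ∧ z i) xor (B j j ∧ z j))
  kernel-pair z supported =
    matVec-pair z supported i , trans (matVec-pair z supported j) (cong (λ b → (b ∧ z i) xor (B j j ∧ z j)) (B-sym j i))

  det₂⇒nonSingular-pair : (B i i ∧ B j j) xor B i j ≡ true → NonSingularOn B (pairSet i j)
  det₂⇒nonSingular-pair det≡true z supported kernel = pointwise
    where
    zᵢ,zⱼ≡0 : z i ≡ false × z j ≡ false
    zᵢ,zⱼ≡0 = nonSingular₂ (B i i) (B j j) (B i j) (z i) (z j) det≡true
      (trans (sym (proj₁ (kernel-pair z supported))) (kernel i (pairSet-left i≢j)))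
      (trans (sym (proj₂ (kernel-pair z supported))) (kernel j (pairSet-right i≢j)))
    pointwise : ∀ k → z k ≡ false
    pointwise k with k Fin.≟ i | k Fin.≟ j
    ... | yes refl | _ = proj₁ zᵢ,zⱼ≡0
    ... | no _ | yes refl = proj₂ zᵢ,zⱼ≡0
    ... | no k≢i | no k≢j = supported k (pairSet-outside i≢j k k≢i k≢j)

  -- a kernel vector (x, y) of the 2×2 submatrix is one of B once placed at i and j
  kernelVector₂≡0 : NonSingularOn B (pairSet i j) → ∀ x y →
    (B i i ∧ x) xor (B i j ∧ y) ≡ false → (B i j ∧ x) xor (B j j ∧ y) ≡ false → x ≡ false × y ≡ false
  kernelVector₂≡0 nonSingular x y eqᵢ eqⱼ = trans (sym zᵢ) (z≡0 i) , trans (sym zⱼ) (z≡0 j)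
    where
    z = pairVector i≢j x y
    zᵢ = pairVector-left i≢j x y
    zⱼ = pairVector-right i≢j x y
    supported = pairVector-supported i≢j x y
    kernel : ∀ k → pairSet i j k ≡ true → matVec B z k ≡ false
    kernel k k∈pair with pairSet-member i≢j k∈pair
    ... | inj₁ refl = trans (proj₁ (kernel-pair z supported))
                            (subst₂ (λ a b → (B i i ∧ a) xor (B i j ∧ b) ≡ false) (sym zᵢ) (sym zⱼ) eqᵢ)
    ... | inj₂ refl = trans (proj₂ (kernel-pair z supported))
                            (subst₂ (λ a b → (B i j ∧ a) xor (B j j ∧ b) ≡ false) (sym zᵢ) (sym zⱼ) eqⱼ)
    z≡0 : ∀ k → z k ≡ false
    z≡0 = nonSingular z supported kernel

  nonSingular-pair⇒det₂ : NonSingularOn B (pairSet i j) → (B i i ∧ B j j) xor B i j ≡ true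
  nonSingular-pair⇒det₂ nonSingular = ¬-not λ det≡false →
    let (x , y , x∨y , eqᵢ , eqⱼ) = singular₂ (B i i) (B j j) (B i j) det≡false
        (x≡0 , y≡0) = kernelVector₂≡0 nonSingular x y eqᵢ eqⱼ
    in true≢false (trans (sym x∨y) (cong₂ _∨_ x≡0 y≡0))

  nonSingular-pair : NonSingularOn B (pairSet i j) ⇔ ((B i i ∧ B j j) xor B i j ≡ true)
  nonSingular-pair = mk⇔ nonSingular-pair⇒det₂ det₂⇒nonSingular-pair

module _ (B B′ : Matrix n) (sameNonSingular : ∀ P → NonSingularOn B P ⇔ NonSingularOn B′ P) where

  diagonal-determined : ∀ i → B i i ≡ B′ i i
  diagonal-determined i = true⇔true⇒≡ (⇔-trans (⇔-sym (nonSingular-single B i))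
                                        (⇔-trans (sameNonSingular (δ i)) (nonSingular-single B′ i)))

  symmetric-determined : Symmetric B → Symmetric B′ → ∀ i j → B i j ≡ B′ i j
  symmetric-determined B-sym B′-sym i j with i Fin.≟ j
  ... | yes refl = diagonal-determined i
  ... | no i≢j = begin
    B i j                                                ≡⟨ sym (xor-cancelˡ (B i i ∧ B j j) (B i j)) ⟩
    (B i i ∧ B j j) xor ((B i i ∧ B j j) xor B i j)
      ≡⟨ cong₂ _xor_ (cong₂ _∧_ (diagonal-determined i) (diagonal-determined j)) det≡det′ ⟩
    (B′ i i ∧ B′ j j) xor ((B′ i i ∧ B′ j j) xor B′ i j) ≡⟨ xor-cancelˡ (B′ i i ∧ B′ j j) (B′ i j) ⟩
    B′ i j                                               ∎
    where
    open ≡-Reasoning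
    xor-cancelˡ : ∀ x y → x xor (x xor y) ≡ y
    xor-cancelˡ x y = trans (sym (xor-assoc x x y)) (cong (_xor y) (xor-same x))
    det≡det′ : (B i i ∧ B j j) xor B i j ≡ (B′ i i ∧ B′ j j) xor B′ i j
    det≡det′ = true⇔true⇒≡ (⇔-trans (⇔-sym (nonSingular-pair B B-sym i≢j))
                             (⇔-trans (sameNonSingular (pairSet i j)) (nonSingular-pair B′ B′-sym i≢j)))

adjMatrix-symmetric : (G : FramedGraph n) → Symmetric (adjMatrix G)
adjMatrix-symmetric G i j with i Fin.≟ j | j Fin.≟ i
... | yes refl | yes _ = refl
... | no _ | no _ = FramedGraph.symm G i j
... | yes i≡j | no j≢i = ⊥-elim (j≢i (sym i≡j))
... | no i≢j | yes j≡i = ⊥-elim (i≢j (sym j≡i))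

framedGraph : (B : Matrix n) → Symmetric B → FramedGraph n
framedGraph B B-sym = record
  { adj = λ i j → if does (i Fin.≟ j) then false else B i j
  ; symm = symm
  ; noLoop = noLoop
  ; frame = λ i → B i i
  }
  where
  symm : ∀ i j → (if does (i Fin.≟ j) then false else B i j) ≡ (if does (j Fin.≟ i) then false else B j i)
  symm i j with i Fin.≟ j | j Fin.≟ i
  ... | yes _ | yes _ = refl
  ... | no _ | no _ = B-sym i j
  ... | yes i≡j | no j≢i = ⊥-elim (j≢i (sym i≡j))
  ... | no i≢j | yes j≡i = ⊥-elim (i≢j (sym j≡i))
  noLoop : ∀ i → (if does (i Fin.≟ i) then false else B i i) ≡ false
  noLoop i rewrite δ-refl i = refl

adjMatrix-framedGraph : ∀ (B : Matrix n) B-sym i j → adjMatrix (framedGraph B B-sym) i j ≡ B i j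
adjMatrix-framedGraph B B-sym i j with i Fin.≟ j
... | yes refl = refl
... | no _ = refl

nonSingularOn-congˡ : ∀ {B B′ : Matrix n} → (∀ i j → B i j ≡ B′ i j) → ∀ P →
  NonSingularOn B P ⇔ NonSingularOn B′ P
nonSingularOn-congˡ B≗B′ P = mk⇔ (transfer B≗B′) (transfer (λ i j → sym (B≗B′ i j)))
  where
  transfer : ∀ {C C′ : Matrix _} → (∀ i j → C i j ≡ C′ i j) → NonSingularOn C P → NonSingularOn C′ P
  transfer C≗C′ nonSingular z supported kernel =
    nonSingular z supported (λ i Pᵢ → trans (xorOver-cong (λ j → cong (_∧ z j) (C≗C′ i j))) (kernel i Pᵢ))

nonSingularOn-congʳ : ∀ (B : Matrix n) {P Q} → (∀ i → P i ≡ Q i) → NonSingularOn B P ⇔ NonSingularOn B Q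
nonSingularOn-congʳ B P≗Q = mk⇔ (transfer P≗Q) (transfer (sym ∘ P≗Q))
  where
  transfer : ∀ {P Q : Row _} → (∀ i → P i ≡ Q i) → NonSingularOn B P → NonSingularOn B Q
  transfer P≗Q nonSingular z supported kernel =
    nonSingular z (λ i Pᵢ → supported i (trans (sym (P≗Q i)) Pᵢ)) (λ i Pᵢ → kernel i (trans (sym (P≗Q i)) Pᵢ))

ΦG⇔nonSingular : ∀ (G : FramedGraph n) U → ΦG G U ⇔ NonSingularOn (adjMatrix G) (lookup U)
ΦG⇔nonSingular G U = detSub-elems⇔nonSingular (adjMatrix G) (adjMatrix-symmetric G) U

Δ-involutive : ∀ (X S : Subset n) → (X Δ S) Δ S ≡ X
Δ-involutive X S = lookup-ext λ i →
  trans (lookup-zipWith _xor_ i (X Δ S) S)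
        (trans (cong (_xor lookup S i) (lookup-zipWith _xor_ i X S)) (xor-cancelʳ (lookup X i) (lookup S i)))

twist⇔ : ∀ (Φ : Family n) S X → twist Φ S X ⇔ Φ (X Δ S)
twist⇔ Φ S X = mk⇔
  (λ { (φ , Φφ , refl) → subst Φ (sym (Δ-involutive φ S)) Φφ })
  (λ ΦXΔS → X Δ S , ΦXΔS , sym (Δ-involutive X S))

Ψ-swap⇔nonSingular : ∀ (L₀ : SubsetV n) (B : Matrix n) → IsGraph L₀ B → ∀ S X →
  Ψ (L₀ ∘ swap S) X ⇔ NonSingularOn B (lookup (X Δ S))
Ψ-swap⇔nonSingular L₀ B isGraph S X =
  ⇔-trans (Ψ⇔Transversal (L₀ ∘ swap S) X)
    (⇔-trans (Transversal-swap L₀ X S) (transversal⇔nonSingular L₀ B isGraph (X Δ S)))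

Ψ-cong : ∀ {L L′ : SubsetV n} → (∀ v → L v ≡ L′ v) → ∀ X → Ψ L X → Ψ L′ X
Ψ-cong L≗L′ X ψ v v∈L′ = ψ v (trans (L≗L′ v) v∈L′)

∘swap-involutive : ∀ (L : SubsetV n) S v → L v ≡ (L ∘ swap S ∘ swap S) v
∘swap-involutive L S v = cong L (sym (swap-involutive S v))

transversal⇒graph : ∀ (L : SubsetV n) → IsLagrangian L → ∀ S → Transversal L S →
  ∃ λ B → Symmetric B × IsGraph (L ∘ swap S) B
transversal⇒graph L lagrangian S transversal =
  transversal∅⇒graph (L ∘ swap S) (swap-isLagrangian S L lagrangian)
    (Equivalence.from (Transversal-swap L ∅ S) (subst (Transversal L) (sym (∅Δ S)) transversal))
  where
  ∅Δ : ∀ S → ∅ Δ S ≡ S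
  ∅Δ S = lookup-ext λ i → trans (lookup-zipWith _xor_ i ∅ S) (cong (_xor lookup S i) (lookup-replicate i false))

Ψ⇔nonSingular : ∀ (L : SubsetV n) B S → IsGraph (L ∘ swap S) B → ∀ X → Ψ L X ⇔ NonSingularOn B (lookup (X Δ S))
Ψ⇔nonSingular L B S isGraph X =
  ⇔-trans (mk⇔ (Ψ-cong (∘swap-involutive L S) X) (Ψ-cong (sym ∘ ∘swap-involutive L S) X)) (Ψ-swap⇔nonSingular (L ∘ swap S) B isGraph S X)

Ψ-binaryDeltaMatroid : ∀ (L : SubsetV n) → IsLagrangian L → IsSetSystem (Ψ L) × IsBinaryDeltaMatroid (Ψ L)
Ψ-binaryDeltaMatroid L lagrangian =
  let (S , transversal) = lagrangian⇒transversal L lagrangian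
      (B , B-sym , isGraph) = transversal⇒graph L lagrangian S transversal
  in (S , Equivalence.from (Ψ⇔Transversal L S) transversal)
   , framedGraph B B-sym , S , λ X →
       ⇔-trans (Ψ⇔nonSingular L B S isGraph X)
         (⇔-sym (⇔-trans (twist⇔ (ΦG (framedGraph B B-sym)) S X)
           (⇔-trans (ΦG⇔nonSingular (framedGraph B B-sym) (X Δ S))
                    (nonSingularOn-congˡ (adjMatrix-framedGraph B B-sym) (lookup (X Δ S))))))

sameΨ⇒sameNonSingular : ∀ (L L′ : SubsetV n) → Ψ L ≐ Ψ L′ → ∀ S {B B′} →
  IsGraph (L ∘ swap S) B → IsGraph (L′ ∘ swap S) B′ → ∀ P → NonSingularOn B P ⇔ NonSingularOn B′ P
sameΨ⇒sameNonSingular L L′ Ψ≐Ψ′ S {B} {B′} isGraph isGraph′ P =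
  ⇔-trans (nonSingularOn-congʳ B (sym ∘ P≗))
    (⇔-trans (⇔-sym (Ψ⇔nonSingular L B S isGraph X))
      (⇔-trans (Ψ≐Ψ′ X) (⇔-trans (Ψ⇔nonSingular L′ B′ S isGraph′ X) (nonSingularOn-congʳ B′ P≗))))
  where
  X : Subset _
  X = tabulate P Δ S
  P≗ : ∀ i → lookup (X Δ S) i ≡ P i
  P≗ i = trans (cong (λ Z → lookup Z i) (Δ-involutive (tabulate P) S)) (lookup∘tabulate P i)

graph-unique : ∀ {L L′ : SubsetV n} {B B′} → IsGraph L B → IsGraph L′ B′ → (∀ i j → B i j ≡ B′ i j) →
  ∀ v → L v ≡ L′ v
graph-unique {B = B} {B′} isGraph isGraph′ B≗B′ v =
  true⇔true⇒≡ (⇔-trans (isGraph v) (⇔-trans (mk⇔ (onGraph-cong B≗B′) (onGraph-cong (λ i j → sym (B≗B′ i j))))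
                                             (⇔-sym (isGraph′ v))))
  where
  onGraph-cong : ∀ {C C′ : Matrix _} → (∀ i j → C i j ≡ C′ i j) → OnGraph C v → OnGraph C′ v
  onGraph-cong C≗C′ onGraph i = trans (onGraph i) (xorOver-cong (λ j → cong (_∧ coord true v j) (C≗C′ i j)))

Ψ-injective : ∀ (L L′ : SubsetV n) → IsLagrangian L → IsLagrangian L′ → Ψ L ≐ Ψ L′ → ∀ v → L v ≡ L′ v
Ψ-injective L L′ lagrangian lagrangian′ Ψ≐Ψ′ v =
  let (S , transversal) = lagrangian⇒transversal L lagrangian
      transversal′ = Equivalence.to (Ψ⇔Transversal L′ S)
                       (Equivalence.to (Ψ≐Ψ′ S) (Equivalence.from (Ψ⇔Transversal L S) transversal))
      (B , B-sym , isGraph) = transversal⇒graph L lagrangian S transversal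
      (B′ , B′-sym , isGraph′) = transversal⇒graph L′ lagrangian′ S transversal′
      B≗B′ = symmetric-determined B B′ (sameΨ⇒sameNonSingular L L′ Ψ≐Ψ′ S isGraph isGraph′) B-sym B′-sym
  in trans (∘swap-involutive L S v) (trans (graph-unique isGraph isGraph′ B≗B′ (swap S v)) (sym (∘swap-involutive L′ S v)))

Ψ-surjective : ∀ (Φ : Family n) → IsBinaryDeltaMatroid Φ → ∃[ L ] (IsLagrangian L × Ψ L ≐ Φ)
Ψ-surjective Φ (G , S , Φ≐twist) =
  graph (adjMatrix G) ∘ swap S ,
  swap-isLagrangian S _ (graph-isLagrangian (adjMatrix G) (adjMatrix-symmetric G)) ,
  λ X → ⇔-trans (Ψ-swap⇔nonSingular _ (adjMatrix G) (graph-isGraph (adjMatrix G)) S X)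
          (⇔-sym (⇔-trans (Φ≐twist X) (⇔-trans (twist⇔ (ΦG G) S X) (ΦG⇔nonSingular G (X Δ S)))))

theorem2p1 : (n : ℕ) →
    -- ν_E maps 𝓛_E into 𝓑_E
    (∀ (L : SubsetV n) → IsLagrangian L →
        IsSetSystem (Ψ L) × IsBinaryDeltaMatroid (Ψ L))
    -- ν_E is injective
    × (∀ (L L' : SubsetV n) → IsLagrangian L → IsLagrangian L' →
        Ψ L ≐ Ψ L' → ∀ v → L v ≡ L' v)
    -- ν_E is onto 𝓑_E
    × (∀ (Φ : Family n) → IsBinaryDeltaMatroid Φ →
        ∃[ L ] (IsLagrangian L × Ψ L ≐ Φ))
theorem2p1 n = Ψ-binaryDeltaMatroid , Ψ-injective , Ψ-surjective
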